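{- Let $\Sigma$ be a finite alphabet. If a total function $f:\Sigma^*\to\Sigma^*$ is in FPTIME, then $f$ is computable in ForNo, i.e. there exist a ForNo term $T$, registers $\mathrm{in},\mathrm{out}$ of $T$ and an encoding $\langle\!\langle\cdot\rangle\!\rangle$ such that $T$ computes $f$.
   Context: FPTIME: $f$ is in FPTIME if there is a deterministic single-tape Turing machine $M$ (semi-infinite tape, input alphabet $\Sigma$, tape alphabet $\Gamma\supset\Sigma$ containing a blank not in $\Sigma$) and a polynomial $p$ such that on every input $w\in\Sigma^*$, $M$ started in its initial state with $w$ on the tape and head on the leftmost cell halts within $p(|w|)$ steps, with only $f(w)$ on its tape and head on the leftmost cell. Stacks and states: stacks are finite lists of natural numbers, $[\,]$ empty, $n::t$ has top $n$; $|s|$ is the length. Registers come from a countable set. A store $\phi$ maps every register to a stack; $\varnothing$ maps every register to $[\,]$, and $\phi[x\to s]$ updates $x$. A state is a pair $(\phi,c)$ with $c\in\mathbb N$ an error counter; $\omega(x)$ denotes $\phi(x)$ for $\omega=(\phi,c)$. Raw terms (start symbol $T$, $n\in\mathbb N$, $x,y$ registers): $T ::= A \mid T;T \mid \mathtt{IF}\ x = n\ \{T\} \mid \mathtt{NORMAL}\ N\ \{S\}$; $N ::= y \mid y,N$; $A ::= \mathtt{SKIP}\mid \mathtt{PUSH}[n]\ x \mid \mathtt{POP}[n]\ x$; $S ::= A \mid S;S \mid \mathtt{IF}\ x=n\ \{S\} \mid \mathtt{FOR}\ x\ C \mid \mathtt{ROF}\ x\ C$; $C ::= \{S\} \mid \{S\}\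 C$. $\mathtt{PUSH}/\mathtt{POP}$ "write" their register; $x$ "leads" $\mathtt{IF}\ x=n$, $\mathtt{FOR}\ x$, $\mathtt{ROF}\ x$. ForNo is the set of raw terms generated from $T$ such that: (i) if $x$ leads a selection or iteration with bodies $S_1,\dots,S_k$, no atomic term in these bodies writes $x$; (ii) the registers listed in $N$ of $\mathtt{NORMAL}\ N\ \{S\}$ are not written in $S$ and are the only registers that can lead iterations in $S$. Semantics (big-step, judgments $\langle T,\omega\rangle\Downarrow\omega'$): $\mathtt{SKIP}$ leaves the state unchanged; $T;U$ runs $T$ then $U$; $\mathtt{PUSH}[n]\ x$ on $(\phi,c)$ yields $(\phi[x\to s],c')$ where $\mathrm{push}_n(\phi(x),c)=(s,c')$, and $\mathtt{POP}[n]\ x$ likewise with $\mathrm{pop}_n$; here $\mathrm{push}_n,\mathrm{pop}_n:\mathcal S\times\mathbb N\to\mathcal S\times\mathbb N$ are fixed, mutually inverse total functions with $\mathrm{push}_n(s,0)=(n::s,0)$, $\mathrm{pop}_n(n::s,0)=(s,0)$, and if the top of $s$ is not $n$ then $\mathrm{pop}_n(s,0)=(s,1)$ (the counter records failed pops). $\mathtt{IF}\ x=n\ \{P\}$ runs $P$ if $\omega(x)$ is nonempty with top $n$, otherwise does nothing. $\mathtt{FOR}\ x\ \{P_0\}\dots\{P_k\}$ takes the stack $\omega(x)$ at entry and, for each of its elements $i$ in order from the top down, runs $P_{\min(i,k)}$ (so exactly $|\omega(x)|$ steps); $\mathtt{ROF}$ does the same on the reversal of $\omega(x)$. $\mathtt{NORMAL}\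 N\ \{T\}$ runs $T$. Encoding and computation: an encoding is a bijection $\langle\!\langle\cdot\rangle\!\rangle:\Sigma\to\{0,\dots,|\Sigma|-1\}$, extended to strings by $\langle\!\langle\epsilon\rangle\!\rangle=[\,]$, $\langle\!\langle a\cdot x\rangle\!\rangle=\langle\!\langle a\rangle\!\rangle::\langle\!\langle x\rangle\!\rangle$. A term $T$ with registers $\mathrm{in},\mathrm{out}$ (not necessarily distinct) computes a total $f:\Sigma^*\to\Sigma^*$ if for every $x\in\Sigma^*$ there is $\phi$ with $\langle T,(\varnothing[\mathrm{in}\to\langle\!\langle x\rangle\!\rangle],0)\rangle\Downarrow(\phi,0)$ and $\phi(\mathrm{out})=\langle\!\langle f(x)\rangle\!\rangle$. -}

module Defs where

open import Data.Nat using (ℕ; zero; suc; _+_; _*_; _≤_; _≟_)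
open import Data.Fin using (Fin; toℕ)
open import Data.List using (List; []; _∷_; _++_; map; length; reverse; head)
open import Data.List.Membership.Propositional using (_∈_; _∉_)
open import Data.Maybe using (Maybe; just; nothing; _>>=_)
open import Data.Product using (Σ; Σ-syntax; _×_; _,_; proj₁; proj₂)
open import Data.Sum using (_⊎_; inj₁; inj₂)
open import Data.Unit using (⊤)
open import Relation.Nullary using (¬_; yes; no)
open import Relation.Binary.PropositionalEquality using (_≡_)
open import Function.Bundles using (_↔_; Inverse)

-- Polynomials with natural coefficients (coefficient list, lowest first)

Poly : Set
Poly = List ℕ

evalPoly : Poly → ℕ → ℕ
evalPoly []       n = 0
evalPoly (a ∷ as) n = a + n * evalPoly as n

-- Deterministic single-tape Turing machines, semi-infinite tape.
-- Tape alphabet Γ = A ⊎ Fin (suc e) : contains A, blank = inj₂ zero ∉ A.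

Gam : Set → ℕ → Set
Gam A e = A ⊎ Fin (suc e)

blank : {A : Set} {e : ℕ} → Gam A e
blank = inj₂ Fin.zero
  where import Data.Fin as Fin

data Move : Set where
  L R : Move

record TM (A : Set) : Set where
  field
    nQ    : ℕ
    nE    : ℕ
    start : Fin nQ
    -- transition function; 'nothing' means the machine halts
    δ     : Fin nQ → Gam A nE → Maybe (Fin nQ × Gam A nE × Move)

module _ {A : Set} (M : TM A) where
  open TM M

  record Config : Set where
    constructor conf
    field
      state : Fin nQ
      tape  : ℕ → Gam A nE
      pos   : ℕ

  listTape : List (Gam A nE) → ℕ → Gam A nE
  listTape []       i       = blank
  listTape (a ∷ as) zero    = a
  listTape (a ∷ as) (suc i) = listTape as i

  writeTape : (ℕ → Gam A nE) → ℕ → Gam A nE → ℕ → Gam A nE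
  writeTape t h a i with i ≟ h
  ... | yes _ = a
  ... | no  _ = t i

  -- moving left from the leftmost cell leaves the head where it is
  move : Move → ℕ → ℕ
  move L zero    = zero
  move L (suc h) = h
  move R h       = suc h

  step : Config → Maybe Config
  step (conf q t h) with δ q (t h)
  ... | nothing            = nothing
  ... | just (q' , a , m)  = just (conf q' (writeTape t h a) (move m h))

  Halted : Config → Set
  Halted c = step c ≡ nothing

  steps : ℕ → Config → Maybe Config
  steps zero    c = just c
  steps (suc n) c = step c >>= steps n

  initConf : List A → Config
  initConf w = conf start (listTape (map inj₁ w)) 0

FPTIME : (A : Set) → (List A → List A) → Set
FPTIME A f =
  Σ[ M ∈ TM A ] Σ[ p ∈ Poly ] ∀ (w : List A) →
    Σ[ t ∈ ℕ ] Σ[ c ∈ Config M ]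
      t ≤ evalPoly p (length w)
      × steps M t (initConf M w) ≡ just c
      × Halted M c
      × Config.pos c ≡ 0
      × (∀ i → Config.tape c i ≡ listTape M (map inj₁ (f w)) i)

Reg : Set
Reg = ℕ

data Atom : Set where
  SKIP     : Atom
  PUSH POP : ℕ → Reg → Atom

-- S-terms.  FOR x b bs  represents  FOR x {b} {bs₁} … {bsₖ}
data STerm : Set where
  atomS : Atom → STerm
  _⨾_   : STerm → STerm → STerm
  IFS   : Reg → ℕ → STerm → STerm
  FOR   : Reg → STerm → List STerm → STerm
  ROF   : Reg → STerm → List STerm → STerm

-- T-terms.  NORMAL y ys P  represents  NORMAL y,ys₁,…,ysₘ {P}
data Term : Set where
  atomT  : Atom → Term
  _⨾T_   : Term → Term → Term
  IFT    : Reg → ℕ → Term → Term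
  NORMAL : Reg → List Reg → STerm → Term

writtenA : Atom → List Reg
writtenA SKIP       = []
writtenA (PUSH n x) = x ∷ []
writtenA (POP n x)  = x ∷ []

mutual
  writtenS : STerm → List Reg
  writtenS (atomS a)    = writtenA a
  writtenS (P ⨾ Q)      = writtenS P ++ writtenS Q
  writtenS (IFS x n P)  = writtenS P
  writtenS (FOR x b bs) = writtenS b ++ writtenL bs
  writtenS (ROF x b bs) = writtenS b ++ writtenL bs

  writtenL : List STerm → List Reg
  writtenL []       = []
  writtenL (P ∷ Ps) = writtenS P ++ writtenL Ps

writtenT : Term → List Reg
writtenT (atomT a)       = writtenA a
writtenT (P ⨾T Q)        = writtenT P ++ writtenT Q
writtenT (IFT x n P)     = writtenT P
writtenT (NORMAL y ys P) = writtenS P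

mutual
  itersS : STerm → List Reg
  itersS (atomS a)    = []
  itersS (P ⨾ Q)      = itersS P ++ itersS Q
  itersS (IFS x n P)  = itersS P
  itersS (FOR x b bs) = x ∷ (itersS b ++ itersL bs)
  itersS (ROF x b bs) = x ∷ (itersS b ++ itersL bs)

  itersL : List STerm → List Reg
  itersL []       = []
  itersL (P ∷ Ps) = itersS P ++ itersL Ps

mutual
  wfS : STerm → Set
  wfS (atomS a)    = ⊤
  wfS (P ⨾ Q)      = wfS P × wfS Q
  wfS (IFS x n P)  = x ∉ writtenS P × wfS P
  wfS (FOR x b bs) = x ∉ (writtenS b ++ writtenL bs) × wfS b × wfL bs
  wfS (ROF x b bs) = x ∉ (writtenS b ++ writtenL bs) × wfS b × wfL bs

  wfL : List STerm → Set
  wfL []       = ⊤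
  wfL (P ∷ Ps) = wfS P × wfL Ps

ForNo : Term → Set
ForNo (atomT a)       = ⊤
ForNo (P ⨾T Q)        = ForNo P × ForNo Q
ForNo (IFT x n P)     = x ∉ writtenT P × ForNo P
ForNo (NORMAL y ys P) =
  wfS P
  × (∀ z → z ∈ (y ∷ ys) → z ∉ writtenS P)
  × (∀ z → z ∈ itersS P → z ∈ (y ∷ ys))

Stack : Set
Stack = List ℕ

Store : Set
Store = Reg → Stack

emptyStore : Store
emptyStore _ = []

update : Store → Reg → Stack → Store
update φ x s y with y ≟ x
... | yes _ = s
... | no  _ = φ y

record State : Set where
  constructor st
  field
    store : Store
    err   : ℕ

-- The fixed push/pop functions: any mutually inverse total functions
-- with the stated behaviour on counter 0.
record PushPop : Set where
  field
    push pop : ℕ → Stack × ℕ → Stack × ℕ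
    pop-push : ∀ n p → pop n (push n p) ≡ p
    push-pop : ∀ n p → push n (pop n p) ≡ p
    push-0   : ∀ n s → push n (s , 0) ≡ (n ∷ s , 0)
    pop-0    : ∀ n s → pop n (n ∷ s , 0) ≡ (s , 0)
    pop-err  : ∀ n s → ¬ (head s ≡ just n) → pop n (s , 0) ≡ (s , 1)

-- choose b bs i = P_{min(i,k)} for the bodies P₀ = b, P₁…P_k = bs
choose : STerm → List STerm → ℕ → STerm
choose b []       i       = b
choose b (c ∷ cs) zero    = b
choose b (c ∷ cs) (suc i) = choose c cs i

module Semantics (pp : PushPop) where
  open PushPop pp

  evalAtom : Atom → State → State
  evalAtom SKIP       ω        = ω
  evalAtom (PUSH n x) (st φ c) = st (update φ x (proj₁ r)) (proj₂ r)
    where r = push n (φ x , c)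
  evalAtom (POP n x)  (st φ c) = st (update φ x (proj₁ r)) (proj₂ r)
    where r = pop n (φ x , c)

  mutual
    data ExecS : STerm → State → State → Set where
      e-atom : ∀ {a ω} → ExecS (atomS a) ω (evalAtom a ω)
      e-seq  : ∀ {P Q ω ω₁ ω₂} → ExecS P ω ω₁ → ExecS Q ω₁ ω₂ → ExecS (P ⨾ Q) ω ω₂
      e-ifT  : ∀ {x n P ω ω'} → head (State.store ω x) ≡ just n →
               ExecS P ω ω' → ExecS (IFS x n P) ω ω'
      e-ifF  : ∀ {x n P ω} → ¬ (head (State.store ω x) ≡ just n) →
               ExecS (IFS x n P) ω ω
      e-for  : ∀ {x b bs ω ω'} → Loop b bs (State.store ω x) ω ω' →
               ExecS (FOR x b bs) ω ω'
      e-rof  : ∀ {x b bs ω ω'} → Loop b bs (reverse (State.store ω x)) ω ω' →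
               ExecS (ROF x b bs) ω ω'

    -- run the bodies according to the list of elements (top first)
    data Loop (b : STerm) (bs : List STerm) : Stack → State → State → Set where
      l-nil  : ∀ {ω} → Loop b bs [] ω ω
      l-cons : ∀ {i is ω ω₁ ω₂} → ExecS (choose b bs i) ω ω₁ →
               Loop b bs is ω₁ ω₂ → Loop b bs (i ∷ is) ω ω₂

  data ExecT : Term → State → State → Set where
    t-atom   : ∀ {a ω} → ExecT (atomT a) ω (evalAtom a ω)
    t-seq    : ∀ {P Q ω ω₁ ω₂} → ExecT P ω ω₁ → ExecT Q ω₁ ω₂ → ExecT (P ⨾T Q) ω ω₂
    t-ifT    : ∀ {x n P ω ω'} → head (State.store ω x) ≡ just n →
               ExecT P ω ω' → ExecT (IFT x n P) ω ω'
    t-ifF    : ∀ {x n P ω} → ¬ (head (State.store ω x) ≡ just n) →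
               ExecT (IFT x n P) ω ω
    t-normal : ∀ {y ys P ω ω'} → ExecS P ω ω' → ExecT (NORMAL y ys P) ω ω'

  encode : {A : Set} {k : ℕ} → A ↔ Fin k → List A → Stack
  encode enc = map (λ a → toℕ (Inverse.to enc a))

  Computes : {A : Set} {k : ℕ} → Term → Reg → Reg → A ↔ Fin k →
             (List A → List A) → Set
  Computes T inR outR enc f =
    ∀ x → Σ[ φ ∈ Store ]
      ExecT T (st (update emptyStore inR (encode enc x)) 0) (st φ 0)
      × φ outR ≡ encode enc (f x)

-- A polynomial-time machine is simulated inside one NORMAL block in which only the input
-- register leads loops and is never written.  The tape is kept in two stacks, the cells
-- left of the head and the rest.  One machine step is loop-free: the scanned symbol is
-- copied to a scratch register, the transition is selected by nested case distinctions on
-- state and symbol, and the head moves by transferring one cell between the two stacks.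
-- FOR loops over the input nested by Horner's scheme repeat the step evalPoly p n times,
-- which suffices since a halted configuration is a fixed point; similar loops then move
-- the tape out, strip its trailing blanks and reverse it into the output register.  No
-- pop ever fails, so the run keeps error counter 0.

module Submission where

open import Defs
open import Data.Bool using (Bool; true; false; if_then_else_; T; not; _∧_)
open import Data.Empty using (⊥; ⊥-elim)
open import Data.Fin using (Fin; toℕ; fromℕ<)
open import Data.Fin.Properties using (toℕ<n; fromℕ<-toℕ)
open import Data.List using (List; []; _∷_; _++_; _ʳ++_; reverse; head; length; map; replicate)
open import Data.List.Properties
open import Data.List.Membership.Propositional using (_∉_)
open import Data.List.Relation.Unary.All as All using (All; []; _∷_)
open import Data.List.Relation.Unary.All.Properties using (++⁺; All¬⇒¬Any)
open import Data.List.Relation.Unary.Any using (here)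
open import Data.Maybe using (Maybe; just; nothing; _>>=_)
import Data.Maybe as Maybe
open import Data.Maybe.Properties using (just-injective)
open import Data.Nat using (ℕ; zero; suc; pred; _+_; _*_; _∸_; _≡ᵇ_; _<_; _≤_; _≟_; _<?_; s≤s; z≤n)
open import Data.Nat.Properties
open import Data.Product using (Σ; Σ-syntax; _×_; _,_; proj₁; proj₂)
open import Data.Sum using (_⊎_; inj₁; inj₂)
open import Data.Unit using (⊤; tt)
open import Function using (case_of_; _∘′_)
open import Function.Bundles using (_↔_; Inverse)
open import Relation.Nullary using (¬_; yes; no)
open import Relation.Binary.PropositionalEquality

-- An evaluator: nothing marks a failed pop, so a successful evaluation is an error-free run

topIs : Stack → ℕ → Bool
topIs []      n = false
topIs (m ∷ s) n = m ≡ᵇ n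

popTop : ℕ → Stack → Maybe Stack
popTop n []      = nothing
popTop n (m ∷ s) = if m ≡ᵇ n then just s else nothing

evalA : Atom → Store → Maybe Store
evalA SKIP       φ = just φ
evalA (PUSH n x) φ = just (update φ x (n ∷ φ x))
evalA (POP n x)  φ = popTop n (φ x) >>= λ s → just (update φ x s)

evalLoop : (ℕ → Store → Maybe Store) → Stack → Store → Maybe Store
evalLoop f []       φ = just φ
evalLoop f (i ∷ is) φ = f i φ >>= evalLoop f is

mutual
  evalS : STerm → Store → Maybe Store
  evalS (atomS a)    φ = evalA a φ
  evalS (P ⨾ Q)      φ = evalS P φ >>= evalS Q
  evalS (IFS x n P)  φ = if topIs (φ x) n then evalS P φ else just φ
  evalS (FOR x b bs) φ = evalLoop (evalC b bs) (φ x) φ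
  evalS (ROF x b bs) φ = evalLoop (evalC b bs) (reverse (φ x)) φ

  evalC : STerm → List STerm → ℕ → Store → Maybe Store
  evalC b []       i       φ = evalS b φ
  evalC b (c ∷ cs) zero    φ = evalS b φ
  evalC b (c ∷ cs) (suc i) φ = evalC c cs i φ

>>=-just : {A B : Set} (m : Maybe A) (f : A → Maybe B) {y : B} → (m >>= f) ≡ just y →
           Σ A λ x → m ≡ just x × f x ≡ just y
>>=-just (just x) f e = x , refl , e

topIs⇒head : ∀ s n → topIs s n ≡ true → head s ≡ just n
topIs⇒head (m ∷ s) n e = cong just (≡ᵇ⇒≡ m n (subst T (sym e) tt))

head⇒topIs : ∀ s n → head s ≡ just n → topIs s n ≡ true
head⇒topIs (m ∷ s) n refl with m ≡ᵇ m | ≡⇒≡ᵇ m m refl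
... | true | _ = refl

¬head⇒¬topIs : ∀ s n → ¬ (head s ≡ just n) → topIs s n ≡ false
¬head⇒¬topIs []      n ne = refl
¬head⇒¬topIs (m ∷ s) n ne with m ≡ᵇ n in eq
... | false = refl
... | true  = ⊥-elim (ne (cong just (≡ᵇ⇒≡ m n (subst T (sym eq) tt))))

¬topIs⇒¬head : ∀ s n → topIs s n ≡ false → ¬ (head s ≡ just n)
¬topIs⇒¬head s n e h with trans (sym e) (head⇒topIs s n h)
... | ()

module Soundness (pp : PushPop) where
  open PushPop pp
  open Semantics pp

  push-sound : ∀ φ n x → ExecS (atomS (PUSH n x)) (st φ 0) (st (update φ x (n ∷ φ x)) 0)
  push-sound φ n x =
    subst (λ r → ExecS (atomS (PUSH n x)) (st φ 0) (st (update φ x (proj₁ r)) (proj₂ r)))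
          (push-0 n (φ x)) e-atom

  pop-sound : ∀ φ n x s → φ x ≡ n ∷ s → ExecS (atomS (POP n x)) (st φ 0) (st (update φ x s) 0)
  pop-sound φ n x s e =
    subst (λ r → ExecS (atomS (POP n x)) (st φ 0) (st (update φ x (proj₁ r)) (proj₂ r)))
          (trans (cong (λ z → pop n (z , 0)) e) (pop-0 n s)) e-atom

  evalA-sound : ∀ a φ φ' → evalA a φ ≡ just φ' → ExecS (atomS a) (st φ 0) (st φ' 0)
  evalA-sound SKIP       φ .φ refl = e-atom
  evalA-sound (PUSH n x) φ ._ refl = push-sound φ n x
  evalA-sound (POP n x)  φ φ' e with φ x in eq
  ... | m ∷ s with m ≡ᵇ n in eb
  ... | true with ≡ᵇ⇒≡ m n (subst T (sym eb) tt) | e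
  ... | refl | refl = pop-sound φ m x s eq

  mutual
    evalS-sound : ∀ P φ φ' → evalS P φ ≡ just φ' → ExecS P (st φ 0) (st φ' 0)
    evalS-sound (atomS a) φ φ' e = evalA-sound a φ φ' e
    evalS-sound (P ⨾ Q) φ φ' e with >>=-just (evalS P φ) (evalS Q) e
    ... | φ₁ , e₁ , e₂ = e-seq (evalS-sound P φ φ₁ e₁) (evalS-sound Q φ₁ φ' e₂)
    evalS-sound (IFS x n P) φ φ' e with topIs (φ x) n in et
    ... | true           = e-ifT (topIs⇒head (φ x) n et) (evalS-sound P φ φ' e)
    ... | false with e
    ... | refl           = e-ifF (¬topIs⇒¬head (φ x) n et)
    evalS-sound (FOR x b bs) φ φ' e = e-for (evalLoop-sound b bs (φ x) φ φ' e)
    evalS-sound (ROF x b bs) φ φ' e = e-rof (evalLoop-sound b bs (reverse (φ x)) φ φ' e)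

    evalLoop-sound : ∀ b bs is φ φ' → evalLoop (evalC b bs) is φ ≡ just φ' →
                     Loop b bs is (st φ 0) (st φ' 0)
    evalLoop-sound b bs []       φ .φ refl = l-nil
    evalLoop-sound b bs (i ∷ is) φ φ' e with >>=-just (evalC b bs i φ) (evalLoop (evalC b bs) is) e
    ... | φ₁ , e₁ , e₂ = l-cons (evalC-sound b bs i φ φ₁ e₁) (evalLoop-sound b bs is φ₁ φ' e₂)

    evalC-sound : ∀ b bs i φ φ' → evalC b bs i φ ≡ just φ' →
                  ExecS (choose b bs i) (st φ 0) (st φ' 0)
    evalC-sound b []       i       φ φ' e = evalS-sound b φ φ' e
    evalC-sound b (c ∷ cs) zero    φ φ' e = evalS-sound b φ φ' e
    evalC-sound b (c ∷ cs) (suc i) φ φ' e = evalC-sound c cs i φ φ' e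

update-same : ∀ φ x s → update φ x s x ≡ s
update-same φ x s with x ≟ x
... | yes _ = refl
... | no ne = ⊥-elim (ne refl)

update-other : ∀ φ x s y → y ≢ x → update φ x s y ≡ φ y
update-other φ x s y ne with y ≟ x
... | yes e = ⊥-elim (ne e)
... | no _  = refl

-- Freshness is a Boolean test so that, for concrete registers, it is proved by tt.
fresh : ℕ → List ℕ → Bool
fresh z []       = true
fresh z (w ∷ ws) = not (z ≡ᵇ w) ∧ fresh z ws

Frame : List ℕ → Store → Store → Set
Frame ws φ φ' = ∀ z → T (fresh z ws) → φ' z ≡ φ z

fresh-++ˡ : ∀ z ws vs → T (fresh z (ws ++ vs)) → T (fresh z ws)
fresh-++ˡ z []       vs t = tt
fresh-++ˡ z (w ∷ ws) vs t with z ≡ᵇ w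
... | false = fresh-++ˡ z ws vs t

fresh-++ʳ : ∀ z ws vs → T (fresh z (ws ++ vs)) → T (fresh z vs)
fresh-++ʳ z []       vs t = t
fresh-++ʳ z (w ∷ ws) vs t with z ≡ᵇ w
... | false = fresh-++ʳ z ws vs t

fresh-tail : ∀ z w ws → T (fresh z (w ∷ ws)) → T (fresh z ws)
fresh-tail z w = fresh-++ʳ z (w ∷ [])

fresh⇒≢ : ∀ z w ws → T (fresh z (w ∷ ws)) → z ≢ w
fresh⇒≢ z w ws t refl with z ≡ᵇ z | ≡⇒≡ᵇ z z refl
... | true | _ = t

≢⇒fresh : ∀ z w → z ≢ w → T (fresh z (w ∷ []))
≢⇒fresh z w ne with z ≡ᵇ w in eq
... | false = tt
... | true  = ne (≡ᵇ⇒≡ z w (subst T (sym eq) tt))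

frame-++ : ∀ ws vs {φ φ₁ φ₂} → Frame ws φ φ₁ → Frame vs φ₁ φ₂ → Frame (ws ++ vs) φ φ₂
frame-++ ws vs f g z t = trans (g z (fresh-++ʳ z ws vs t)) (f z (fresh-++ˡ z ws vs t))

frame-update : ∀ φ x s → Frame (x ∷ []) φ (update φ x s)
frame-update φ x s z t = update-other φ x s z (fresh⇒≢ z x [] t)

head-≢ : ∀ {s : Stack} {m n} → head s ≡ just m → m ≢ n → ¬ (head s ≡ just n)
head-≢ hm m≢n hn = m≢n (just-injective (trans (sym hm) hn))

seq-just : ∀ P Q {φ φ₁ φ₂} → evalS P φ ≡ just φ₁ → evalS Q φ₁ ≡ just φ₂ →
           evalS (P ⨾ Q) φ ≡ just φ₂
seq-just P Q e₁ e₂ rewrite e₁ = e₂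

Reaches : STerm → Store → (Store → Set) → Set
Reaches P φ Q = Σ Store λ φ' → evalS P φ ≡ just φ' × Q φ'

reaches-mono : ∀ P φ {R S : Store → Set} → (∀ {φ'} → R φ' → S φ') → Reaches P φ R → Reaches P φ S
reaches-mono P φ R⇒S (φ' , e , r) = φ' , e , R⇒S r

reaches-⨾ : ∀ P Q {φ R S} → Reaches P φ R → (∀ {φ₁} → R φ₁ → Reaches Q φ₁ S) → Reaches (P ⨾ Q) φ S
reaches-⨾ P Q (φ₁ , e₁ , r) then with then r
... | φ₂ , e₂ , s = φ₂ , seq-just P Q e₁ e₂ , s

if-true : ∀ x n P φ → head (φ x) ≡ just n → evalS (IFS x n P) φ ≡ evalS P φ
if-true x n P φ h rewrite head⇒topIs (φ x) n h = refl

if-false : ∀ x n P φ → ¬ (head (φ x) ≡ just n) → evalS (IFS x n P) φ ≡ just φ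
if-false x n P φ ne rewrite ¬head⇒¬topIs (φ x) n ne = refl

pop-eval : ∀ n x φ s → φ x ≡ n ∷ s → evalS (atomS (POP n x)) φ ≡ just (update φ x s)
pop-eval n x φ s e rewrite e | head⇒topIs (n ∷ s) n refl = refl

LoopFree : STerm → Set
LoopFree (atomS a)    = ⊤
LoopFree (P ⨾ Q)      = LoopFree P × LoopFree Q
LoopFree (IFS x n P)  = LoopFree P
LoopFree (FOR x b bs) = ⊥
LoopFree (ROF x b bs) = ⊥

loopFree-frame : ∀ P → LoopFree P → ∀ φ φ' → evalS P φ ≡ just φ' → Frame (writtenS P) φ φ'
loopFree-frame (atomS SKIP)       lf φ .φ refl = λ _ _ → refl
loopFree-frame (atomS (PUSH n x)) lf φ ._ refl = frame-update φ x _
loopFree-frame (atomS (POP n x))  lf φ φ' e with >>=-just (popTop n (φ x)) (λ s → just (update φ x s)) e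
... | s , _ , refl = frame-update φ x s
loopFree-frame (P ⨾ Q) (lp , lq) φ φ' e with >>=-just (evalS P φ) (evalS Q) e
... | φ₁ , e₁ , e₂ = frame-++ (writtenS P) (writtenS Q)
                       (loopFree-frame P lp φ φ₁ e₁) (loopFree-frame Q lq φ₁ φ' e₂)
loopFree-frame (IFS x n P) lf φ φ' e with topIs (φ x) n
... | true  = loopFree-frame P lf φ φ' e
... | false with e
... | refl  = λ _ _ → refl

-- rIn holds the input and is the only register leading loops; rLeft and rRight hold the
-- tape, rState the state; rSym, rNext and rMove are scratch space of a step, rTmp of the
-- gadgets; the output is assembled in rRev and rOut.
rIn rLeft rRight rState rSym rNext rMove rTmp rRev rOut : Reg
rIn = 0
rLeft = 1
rRight = 2
rState = 3
rSym = 4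
rNext = 5
rMove = 6
rTmp = 7
rRev = 8
rOut = 9

switch : Reg → ℕ → (ℕ → STerm) → STerm
switch x zero    B = atomS SKIP
switch x (suc n) B = switch x n B ⨾ IFS x n (B n)

switch-miss : ∀ x n B φ → (∀ j → j < n → ¬ (head (φ x) ≡ just j)) → evalS (switch x n B) φ ≡ just φ
switch-miss x zero    B φ h = refl
switch-miss x (suc n) B φ h
  rewrite switch-miss x n B φ (λ j j<n → h j (m<n⇒m<1+n j<n)) = if-false x n (B n) φ (h n ≤-refl)

switch-above : ∀ x n B φ m → head (φ x) ≡ just m → n ≤ m → evalS (switch x n B) φ ≡ just φ
switch-above x n B φ m h n≤m =
  switch-miss x n B φ (λ j j<n e → <-irrefl (just-injective (trans (sym e) h)) (<-≤-trans j<n n≤m))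

-- The later tests on x must fail, so the chosen branch may not change x.
switch-hit : ∀ x n B φ a → head (φ x) ≡ just a → a < n →
             (∀ φ' → evalS (B a) φ ≡ just φ' → φ' x ≡ φ x) →
             evalS (switch x n B) φ ≡ evalS (B a) φ
switch-hit x zero    B φ a h () keeps
switch-hit x (suc n) B φ a h a<1+n keeps with a ≟ n
... | yes refl rewrite switch-above x a B φ a h ≤-refl = if-true x a (B a) φ h
... | no a≢n rewrite switch-hit x n B φ a h (≤∧≢⇒< (≤-pred a<1+n) a≢n) keeps with evalS (B a) φ in eb
...   | nothing = refl
...   | just φ' = if-false x n (B n) φ'
                    (λ e → a≢n (just-injective (trans (sym h) (trans (cong head (sym (keeps φ' refl))) e))))

repeat : ℕ → STerm → STerm
repeat zero    B = atomS SKIP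
repeat (suc a) B = B ⨾ repeat a B

-- Horner's scheme: with |rIn| = n, the body is executed evalPoly p n times.
polyLoop : Poly → STerm → STerm
polyLoop []       B = atomS SKIP
polyLoop (a ∷ as) B = repeat a B ⨾ FOR rIn (polyLoop as B) []

-- Runs B at least evalPoly p n + n times, enough to sweep every tape cell the
-- simulated machine can have visited.
polyLoop⁺ : Poly → STerm → STerm
polyLoop⁺ p B = polyLoop p B ⨾ FOR rIn B []

sweeps : Poly → Stack → ℕ
sweeps p inp = evalPoly p (length inp) + length inp

-- Invariants indexed by the number of executions of the loop body so far.
module Iteration (G : ℕ → Store → Set) (inp : Stack) (G⇒input : ∀ j φ → G j φ → φ rIn ≡ inp) where

  Advances : STerm → ℕ → Set
  Advances C e = ∀ j φ → G j φ → Reaches C φ (G (j + e))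

  retag : ∀ {j j'} → j ≡ j' → ∀ {φ} → G j φ → G j' φ
  retag j≡j' {φ} = subst (λ z → G z φ) j≡j'

  repeat-advances : ∀ B → Advances B 1 → ∀ a → Advances (repeat a B) a
  repeat-advances B h zero    j φ g = φ , refl , retag (sym (+-identityʳ j)) g
  repeat-advances B h (suc a) j φ g =
    reaches-mono (repeat (suc a) B) φ (retag (+-assoc j 1 a))
      (reaches-⨾ B (repeat a B) (h j φ g) (repeat-advances B h a (j + 1) _))

  evalLoop-advances : ∀ C e → Advances C e → ∀ is j φ → G j φ →
                      Σ Store λ φ' → evalLoop (evalC C []) is φ ≡ just φ' × G (j + length is * e) φ'
  evalLoop-advances C e h []       j φ g = φ , refl , retag (sym (+-identityʳ j)) g
  evalLoop-advances C e h (i ∷ is) j φ g with h j φ g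
  ... | φ₁ , e₁ , g₁ with evalLoop-advances C e h is (j + e) φ₁ g₁
  ... | φ₂ , e₂ , g₂ =
    φ₂ , trans (cong (_>>= evalLoop (evalC C []) is) e₁) e₂ , retag (+-assoc j e (length is * e)) g₂

  for-advances : ∀ C e → Advances C e → Advances (FOR rIn C []) (length inp * e)
  for-advances C e h j φ g with evalLoop-advances C e h (φ rIn) j φ g
  ... | φ' , e' , g' = φ' , e' , subst (λ z → G (j + length z * e) φ') (G⇒input j φ g) g'

  polyLoop-advances : ∀ B → Advances B 1 → ∀ p → Advances (polyLoop p B) (evalPoly p (length inp))
  polyLoop-advances B h []       j φ g = φ , refl , retag (sym (+-identityʳ j)) g
  polyLoop-advances B h (a ∷ as) j φ g =
    reaches-mono (polyLoop (a ∷ as) B) φ (retag (+-assoc j a _))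
      (reaches-⨾ (repeat a B) (FOR rIn (polyLoop as B) []) (repeat-advances B h a j φ g)
        (for-advances (polyLoop as B) _ (polyLoop-advances B h as) (j + a) _))

  polyLoop⁺-advances : ∀ B → Advances B 1 → ∀ p → Advances (polyLoop⁺ p B) (sweeps p inp)
  polyLoop⁺-advances B h p j φ g =
    reaches-mono (polyLoop⁺ p B) φ
      (retag (trans (+-assoc j _ _) (cong (λ m → j + (evalPoly p (length inp) + m)) (*-identityʳ _))))
      (reaches-⨾ (polyLoop p B) (FOR rIn B []) (polyLoop-advances B h p j φ g)
        (for-advances B 1 h (j + evalPoly p (length inp)) _))

-- A register leading an IF may not be written in its body, so moveTop first copies the
-- top of X to rTmp and then selects the transfer on rTmp.  Every copy is preceded by the
-- sentinel K, above all symbol codes, so that an empty X selects nothing.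
module CopyMove (K : ℕ) where

  copyCases : Reg → Reg → STerm
  copyCases X Z = switch X K (λ c → atomS (PUSH c Z))

  copyTop : Reg → Reg → STerm
  copyTop X Z = atomS (PUSH K Z) ⨾ copyCases X Z

  copyTop-empty : ∀ X Z φ → X ≢ Z → φ X ≡ [] →
                  Reaches (copyTop X Z) φ λ φ' → φ' Z ≡ K ∷ φ Z × Frame (Z ∷ []) φ φ'
  copyTop-empty X Z φ X≢Z e =
    φ₁ , seq-just (atomS (PUSH K Z)) (copyCases X Z) {φ} refl none , update-same φ Z _ , frame-update φ Z _
    where
      φ₁ = update φ Z (K ∷ φ Z)
      none : evalS (copyCases X Z) φ₁ ≡ just φ₁
      none = switch-miss X K _ φ₁ λ j _ h →
               case trans (sym h) (cong head (trans (update-other φ Z (K ∷ φ Z) X X≢Z) e)) of λ ()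

  copyTop-cons : ∀ X Z φ c s → X ≢ Z → φ X ≡ c ∷ s → c < K →
                 Reaches (copyTop X Z) φ λ φ' → φ' Z ≡ c ∷ K ∷ φ Z × Frame (Z ∷ []) φ φ'
  copyTop-cons X Z φ c s X≢Z e c<K =
    φ₂ , seq-just (atomS (PUSH K Z)) (copyCases X Z) {φ} refl copied ,
    trans (update-same φ₁ Z (c ∷ φ₁ Z)) (cong (c ∷_) (update-same φ Z (K ∷ φ Z))) ,
    λ z t → let z≢Z = fresh⇒≢ z Z [] t in trans (update-other φ₁ Z _ z z≢Z) (update-other φ Z _ z z≢Z)
    where
      φ₁ = update φ Z (K ∷ φ Z)
      φ₂ = update φ₁ Z (c ∷ φ₁ Z)
      copied : evalS (copyCases X Z) φ₁ ≡ just φ₂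
      copied = switch-hit X K _ φ₁ c (cong head (trans (update-other φ Z _ X X≢Z) e)) c<K
                 λ { _ refl → update-other φ₁ Z _ X X≢Z }

  popPush : ℕ → Reg → Reg → STerm
  popPush c X Y = atomS (POP c X) ⨾ atomS (PUSH c Y)

  transferTop : Reg → Reg → STerm
  transferTop X Y = switch rTmp K (λ c → popPush c X Y)

  moveTop : Reg → Reg → STerm
  moveTop X Y = copyTop X rTmp ⨾ transferTop X Y

  moveTop-empty : ∀ X Y φ → X ≢ rTmp → φ X ≡ [] →
                  Reaches (moveTop X Y) φ λ φ' → Frame (rTmp ∷ []) φ φ'
  moveTop-empty X Y φ X≢tmp e with copyTop-empty X rTmp φ X≢tmp e
  ... | φ₁ , copied , φ₁tmp , frame = φ₁ , seq-just (copyTop X rTmp) (transferTop X Y) copied none , frame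
    where
      none : evalS (transferTop X Y) φ₁ ≡ just φ₁
      none = switch-above rTmp K _ φ₁ K (cong head φ₁tmp) ≤-refl

  moveTop-cons : ∀ X Y φ c s → X ≢ rTmp → Y ≢ rTmp → X ≢ Y → φ X ≡ c ∷ s → c < K →
                 Reaches (moveTop X Y) φ λ φ' →
                     φ' X ≡ s × φ' Y ≡ c ∷ φ Y × Frame (rTmp ∷ X ∷ Y ∷ []) φ φ'
  moveTop-cons X Y φ c s X≢tmp Y≢tmp X≢Y e c<K with copyTop-cons X rTmp φ c s X≢tmp e c<K
  ... | φ₁ , copied , φ₁tmp , frame₁ =
    φ₃ , seq-just (copyTop X rTmp) (transferTop X Y) copied moved ,
    trans (update-other φ₂ Y _ X X≢Y) (update-same φ₁ X s) ,
    trans (update-same φ₂ Y _)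
          (cong (c ∷_) (trans (update-other φ₁ X s Y (≢-sym X≢Y)) (frame₁ Y (≢⇒fresh Y rTmp Y≢tmp)))) ,
    frame-++ (rTmp ∷ []) (X ∷ Y ∷ []) frame₁
      (frame-++ (X ∷ []) (Y ∷ []) (frame-update φ₁ X s) (frame-update φ₂ Y _))
    where
      φ₂ = update φ₁ X s
      φ₃ = update φ₂ Y (c ∷ φ₂ Y)
      popPush-eval : evalS (popPush c X Y) φ₁ ≡ just φ₃
      popPush-eval = seq-just (atomS (POP c X)) (atomS (PUSH c Y)) {φ₁}
                       (pop-eval c X φ₁ s (trans (frame₁ X (≢⇒fresh X rTmp X≢tmp)) e)) refl
      keeps-tmp : ∀ φ' → evalS (popPush c X Y) φ₁ ≡ just φ' → φ' rTmp ≡ φ₁ rTmp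
      keeps-tmp φ' e' with trans (sym popPush-eval) e'
      ... | refl = trans (update-other φ₂ Y _ rTmp (≢-sym Y≢tmp)) (update-other φ₁ X s rTmp (≢-sym X≢tmp))
      moved : evalS (transferTop X Y) φ₁ ≡ just φ₃
      moved = trans (switch-hit rTmp K _ φ₁ c (cong head φ₁tmp) c<K keeps-tmp) popPush-eval

module Strip (bc : ℕ) where

  clearFlag : STerm
  clearFlag = atomS (PUSH 0 rTmp)

  setFlag : Reg → STerm
  setFlag X = IFS X bc (atomS (PUSH 1 rTmp))

  remove : Reg → STerm
  remove X = IFS rTmp 1 (atomS (POP bc X))

  strip : Reg → STerm
  strip X = (clearFlag ⨾ setFlag X) ⨾ remove X

  strip-hit : ∀ X φ s → X ≢ rTmp → φ X ≡ bc ∷ s →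
              Reaches (strip X) φ λ φ' → φ' X ≡ s × Frame (rTmp ∷ X ∷ []) φ φ'
  strip-hit X φ s X≢tmp e =
    φ₃ , seq-just (clearFlag ⨾ setFlag X) (remove X) (seq-just clearFlag (setFlag X) refl flag) removed ,
    update-same φ₂ X s , frame
    where
      φ₁ = update φ rTmp (0 ∷ φ rTmp)
      φ₂ = update φ₁ rTmp (1 ∷ φ₁ rTmp)
      φ₃ = update φ₂ X s
      φ₁X : φ₁ X ≡ bc ∷ s
      φ₁X = trans (update-other φ rTmp _ X X≢tmp) e
      flag : evalS (setFlag X) φ₁ ≡ just φ₂
      flag = if-true X bc (atomS (PUSH 1 rTmp)) φ₁ (cong head φ₁X)
      removed : evalS (remove X) φ₂ ≡ just φ₃
      removed = trans (if-true rTmp 1 (atomS (POP bc X)) φ₂ (cong head (update-same φ₁ rTmp (1 ∷ φ₁ rTmp))))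
                     (pop-eval bc X φ₂ s (trans (update-other φ₁ rTmp _ X X≢tmp) φ₁X))
      frame : Frame (rTmp ∷ X ∷ []) φ φ₃
      frame z t = trans (update-other φ₂ X s z (fresh⇒≢ z X [] (fresh-tail z rTmp (X ∷ []) t)))
                    (trans (update-other φ₁ rTmp _ z z≢tmp) (update-other φ rTmp _ z z≢tmp))
        where z≢tmp = fresh⇒≢ z rTmp (X ∷ []) t

  strip-miss : ∀ X φ → X ≢ rTmp → ¬ (head (φ X) ≡ just bc) →
               Reaches (strip X) φ λ φ' → Frame (rTmp ∷ []) φ φ'
  strip-miss X φ X≢tmp ne =
    φ₁ , seq-just (clearFlag ⨾ setFlag X) (remove X) (seq-just clearFlag (setFlag X) refl noFlag) noRemove ,
    frame-update φ rTmp _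
    where
      φ₁ = update φ rTmp (0 ∷ φ rTmp)
      noFlag : evalS (setFlag X) φ₁ ≡ just φ₁
      noFlag = if-false X bc (atomS (PUSH 1 rTmp)) φ₁
                 (λ h → ne (trans (cong head (sym (update-other φ rTmp _ X X≢tmp))) h))
      noRemove : evalS (remove X) φ₁ ≡ just φ₁
      noRemove = if-false rTmp 1 (atomS (POP bc X)) φ₁
                   (λ h → case trans (sym h) (cong head (update-same φ rTmp (0 ∷ φ rTmp))) of λ ())

module Drain (K : ℕ) (X Y : Reg) (X≢tmp : X ≢ rTmp) (Y≢tmp : Y ≢ rTmp) (X≢Y : X ≢ Y) (xs : Stack)
             (inp : Stack) (P : Store → Set) (P⇒input : ∀ φ → P φ → φ rIn ≡ inp)
             (P-frame : ∀ φ φ' → Frame (rTmp ∷ X ∷ Y ∷ []) φ φ' → P φ → P φ') where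
  open CopyMove K

  Invariant : ℕ → Store → Set
  Invariant j φ = P φ × φ Y ʳ++ φ X ≡ xs × (φ X ≡ [] ⊎ j ≤ length (φ Y)) × All (_< K) (φ X)

  open Iteration Invariant inp (λ j φ g → P⇒input φ (proj₁ g))

  moveTop-advances : Advances (moveTop X Y) 1
  moveTop-advances j φ (pφ , e , d , al) with φ X in eX
  ... | [] with moveTop-empty X Y φ X≢tmp eX
  ...   | φ' , moved , fr = φ' , moved , P-frame φ φ' fr' pφ , invariant , inj₁ φ'X , subst (All (_< K)) (sym φ'X) []
    where
      fr' : Frame (rTmp ∷ X ∷ Y ∷ []) φ φ'
      fr' z t = fr z (fresh-++ˡ z (rTmp ∷ []) (X ∷ Y ∷ []) t)
      φ'X : φ' X ≡ []
      φ'X = trans (fr X (≢⇒fresh X rTmp X≢tmp)) eX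
      invariant : φ' Y ʳ++ φ' X ≡ xs
      invariant = trans (cong₂ _ʳ++_ (fr Y (≢⇒fresh Y rTmp Y≢tmp)) φ'X) e
  moveTop-advances j φ (pφ , e , inj₂ j≤ , c<K ∷ al) | c ∷ s
    with moveTop-cons X Y φ c s X≢tmp Y≢tmp X≢Y eX c<K
  ... | φ' , moved , φ'X , φ'Y , fr =
    φ' , moved , P-frame φ φ' fr pφ , trans (cong₂ _ʳ++_ φ'Y φ'X) e ,
    inj₂ (subst (j + 1 ≤_) (sym (cong length φ'Y)) (≤-trans (≤-reflexive (+-comm j 1)) (s≤s j≤))) ,
    subst (All (_< K)) (sym φ'X) al

  drained : ∀ j φ → Invariant j φ → length xs ≤ j → φ Y ≡ reverse xs
  drained j φ (pφ , e , d , al) xs≤j with φ X | d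
  ... | [] | _ = begin
    φ Y                     ≡⟨ reverse-involutive (φ Y) ⟨
    reverse (reverse (φ Y)) ≡⟨ cong reverse (trans (sym (++-identityʳ (reverse (φ Y)))) (sym (ʳ++-defn (φ Y)))) ⟩
    reverse (φ Y ʳ++ [])    ≡⟨ cong reverse e ⟩
    reverse xs              ∎
    where open ≡-Reasoning
  ... | c ∷ s | inj₂ j≤ = ⊥-elim (<-irrefl refl (≤-trans too-long (≤-trans xs≤j j≤)))
    where
      too-long : length (φ Y) < length xs
      too-long = subst (length (φ Y) <_) (trans (sym (length-ʳ++ (φ Y))) (cong length e))
                       (m<m+n (length (φ Y)) (s≤s z≤n))

  drain : ∀ p φ → P φ → φ X ≡ xs → φ Y ≡ [] → All (_< K) xs →
          length xs ≤ sweeps p inp →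
          Reaches (polyLoop⁺ p (moveTop X Y)) φ λ φ' → P φ' × φ' Y ≡ reverse xs
  drain p φ pφ φX φY all<K bound
    with polyLoop⁺-advances (moveTop X Y) moveTop-advances p 0 φ
           (pφ , trans (cong₂ _ʳ++_ φY φX) refl , inj₂ z≤n , subst (All (_< K)) (sym φX) all<K)
  ... | φ' , ran , inv = φ' , ran , proj₁ inv , drained _ φ' inv bound

∸-step : ∀ z j {m} → z ∸ j ≡ m → z ∸ (j + 1) ≡ m ∸ 1
∸-step z j e = trans (sym (∸-+-assoc z j 1)) (cong (_∸ 1) e)

module Trim (bc : ℕ) (X : Reg) (X≢tmp : X ≢ rTmp) (ys : Stack) (top≢bc : ¬ (head ys ≡ just bc)) (z : ℕ)
            (inp : Stack) (P : Store → Set) (P⇒input : ∀ φ → P φ → φ rIn ≡ inp)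
            (P-frame : ∀ φ φ' → Frame (rTmp ∷ X ∷ []) φ φ' → P φ → P φ') where
  open Strip bc

  Invariant : ℕ → Store → Set
  Invariant j φ = P φ × φ X ≡ replicate (z ∸ j) bc ++ ys

  open Iteration Invariant inp (λ j φ g → P⇒input φ (proj₁ g))

  strip-advances : Advances (strip X) 1
  strip-advances j φ (pφ , e) with z ∸ j in ez
  ... | suc m with strip-hit X φ (replicate m bc ++ ys) X≢tmp e
  ...   | φ' , stripped , φ'X , fr =
    φ' , stripped , P-frame φ φ' fr pφ , trans φ'X (cong (λ u → replicate u bc ++ ys) (sym (∸-step z j ez)))
  strip-advances j φ (pφ , e) | zero with strip-miss X φ X≢tmp (λ h → top≢bc (trans (cong head (sym e)) h))
  ...   | φ' , stripped , fr =
    φ' , stripped , P-frame φ φ' (λ w t → fr w (fresh-++ˡ w (rTmp ∷ []) (X ∷ []) t)) pφ ,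
    trans (fr X (≢⇒fresh X rTmp X≢tmp)) (trans e (cong (λ u → replicate u bc ++ ys) (sym (∸-step z j ez))))

  trim : ∀ p φ → P φ → φ X ≡ replicate z bc ++ ys → z ≤ sweeps p inp →
         Reaches (polyLoop⁺ p (strip X)) φ λ φ' → P φ' × φ' X ≡ ys
  trim p φ pφ φX bound with polyLoop⁺-advances (strip X) strip-advances p 0 φ (pφ , φX)
  ... | φ' , ran , (pφ' , φ'X) = φ' , ran , pφ' , trans φ'X (cong (λ u → replicate u bc ++ ys) (m≤n⇒m∸n≡0 bound))

-- Input symbols keep their codes under the encoding, so the input stack already is the
-- coded input tape; the other tape symbols are coded from k on.
module Codes {A : Set} {k : ℕ} (enc : A ↔ Fin k) (nE : ℕ) where

  Γ : Set
  Γ = Gam A nE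

  K : ℕ
  K = k + suc nE

  code : Γ → ℕ
  code (inj₁ a) = toℕ (Inverse.to enc a)
  code (inj₂ j) = k + toℕ j

  blankCode : ℕ
  blankCode = code blank

  code<K : ∀ g → code g < K
  code<K (inj₁ a) = ≤-trans (toℕ<n (Inverse.to enc a)) (m≤m+n k (suc nE))
  code<K (inj₂ j) = +-monoʳ-< k (toℕ<n j)

  decodeFin : (n : ℕ) → ℕ → Maybe (Fin n)
  decodeFin n c with c <? n
  ... | yes c<n = just (fromℕ< c<n)
  ... | no _    = nothing

  decode : ℕ → Maybe Γ
  decode c with c <? k
  ... | yes c<k = just (inj₁ (Inverse.from enc (fromℕ< c<k)))
  ... | no _    = Maybe.map inj₂ (decodeFin (suc nE) (c ∸ k))

  decodeFin-toℕ : ∀ n (i : Fin n) → decodeFin n (toℕ i) ≡ just i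
  decodeFin-toℕ n i with toℕ i <? n
  ... | yes i<n = cong just (fromℕ<-toℕ i i<n)
  ... | no i≮n  = ⊥-elim (i≮n (toℕ<n i))

  decode-code : ∀ g → decode (code g) ≡ just g
  decode-code (inj₁ a) with toℕ (Inverse.to enc a) <? k
  ... | yes a<k = trans (cong (λ i → just (inj₁ (Inverse.from enc i))) (fromℕ<-toℕ _ a<k))
                        (cong (just ∘′ inj₁) (Inverse.strictlyInverseʳ enc a))
  ... | no a≮k  = ⊥-elim (a≮k (toℕ<n _))
  decode-code (inj₂ j) with k + toℕ j <? k
  ... | yes k+j<k = ⊥-elim (<-irrefl refl (≤-trans k+j<k (m≤m+n k (toℕ j))))
  ... | no _ rewrite m+n∸m≡n k (toℕ j) | decodeFin-toℕ (suc nE) j = refl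

  codes<K : ∀ (u : List Γ) → All (_< K) (map code u)
  codes<K []      = []
  codes<K (g ∷ u) = code<K g ∷ codes<K u

  encodeWord : List A → Stack
  encodeWord = map (λ a → toℕ (Inverse.to enc a))

  code-inj₁ : ∀ u → map code (map inj₁ u) ≡ encodeWord u
  code-inj₁ u = sym (map-∘ u)

  encodeWord<k : ∀ u → All (_< k) (encodeWord u)
  encodeWord<k []      = []
  encodeWord<k (a ∷ u) = toℕ<n _ ∷ encodeWord<k u

  head≢blankCode : ∀ {xs} → All (_< k) xs → ¬ (head xs ≡ just blankCode)
  head≢blankCode (c<k ∷ _) e = <-irrefl (trans (just-injective e) (+-identityʳ k)) c<k

module Tapes {A : Set} (M : TM A) where
  open TM M

  listTape-at-length : ∀ (xs : List (Gam A nE)) y ys → listTape M (xs ++ y ∷ ys) (length xs) ≡ y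
  listTape-at-length []       y ys = refl
  listTape-at-length (x ∷ xs) y ys = listTape-at-length xs y ys

  listTape-elsewhere : ∀ (xs : List (Gam A nE)) y z ys i → i ≢ length xs →
                       listTape M (xs ++ y ∷ ys) i ≡ listTape M (xs ++ z ∷ ys) i
  listTape-elsewhere []       y z ys zero    ne = ⊥-elim (ne refl)
  listTape-elsewhere []       y z ys (suc i) ne = refl
  listTape-elsewhere (x ∷ xs) y z ys zero    ne = refl
  listTape-elsewhere (x ∷ xs) y z ys (suc i) ne = listTape-elsewhere xs y z ys i (ne ∘′ cong suc)

  listTape-∷ʳ-blank : ∀ (xs : List (Gam A nE)) i → listTape M xs i ≡ listTape M (xs ++ blank ∷ []) i
  listTape-∷ʳ-blank []       zero    = refl
  listTape-∷ʳ-blank []       (suc i) = refl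
  listTape-∷ʳ-blank (x ∷ xs) zero    = refl
  listTape-∷ʳ-blank (x ∷ xs) (suc i) = listTape-∷ʳ-blank xs i

  writeTape-listTape : ∀ t (xs : List (Gam A nE)) y z ys → (∀ i → t i ≡ listTape M (xs ++ y ∷ ys) i) →
                       ∀ i → writeTape M t (length xs) z i ≡ listTape M (xs ++ z ∷ ys) i
  writeTape-listTape t xs y z ys h i with i ≟ length xs
  ... | yes refl = sym (listTape-at-length xs z ys)
  ... | no ne    = trans (h i) (listTape-elsewhere xs y z ys i ne)

  listTape-ʳ++-at : ∀ (l : List (Gam A nE)) y ys h → h ≡ length l → listTape M (l ʳ++ y ∷ ys) h ≡ y
  listTape-ʳ++-at l y ys h refl rewrite ʳ++-defn l {y ∷ ys} | sym (length-reverse l) = listTape-at-length (reverse l) y ys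

  writeTape-ʳ++ : ∀ t (l : List (Gam A nE)) y z ys h → h ≡ length l →
                  (∀ i → t i ≡ listTape M (l ʳ++ y ∷ ys) i) →
                  ∀ i → writeTape M t h z i ≡ listTape M (l ʳ++ z ∷ ys) i
  writeTape-ʳ++ t l y z ys h refl ht i rewrite ʳ++-defn l {z ∷ ys} | sym (length-reverse l) =
    writeTape-listTape t (reverse l) y z ys (λ j → trans (ht j) (cong (λ u → listTape M u j) (ʳ++-defn l))) i

  listTape-blanks : ∀ (r : List (Gam A nE)) → (∀ i → listTape M r i ≡ blank) → r ≡ replicate (length r) blank
  listTape-blanks []      h = refl
  listTape-blanks (x ∷ r) h = cong₂ _∷_ (h 0) (listTape-blanks r (λ i → h (suc i)))

  listTape-output : ∀ (r : List (Gam A nE)) (u : List A) → (∀ i → listTape M r i ≡ listTape M (map inj₁ u) i) →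
                    r ≡ map inj₁ u ++ replicate (length r ∸ length u) blank
  listTape-output r       []      h = listTape-blanks r h
  listTape-output []      (a ∷ u) h = case h 0 of λ ()
  listTape-output (x ∷ r) (a ∷ u) h = cong₂ _∷_ (h 0) (listTape-output r u (λ i → h (suc i)))

  next : Config M → Config M
  next c with step M c
  ... | just c' = c'
  ... | nothing = c

  run : ℕ → Config M → Config M
  run zero    c = c
  run (suc j) c = run j (next c)

  steps⇒run : ∀ t c c' → steps M t c ≡ just c' → run t c ≡ c'
  steps⇒run zero    c .c refl = refl
  steps⇒run (suc t) c c' e with step M c
  ... | just c₁ = steps⇒run t c₁ c' e

  run-halted : ∀ d c → Halted M c → run d c ≡ c
  run-halted zero    c h = refl
  run-halted (suc d) c h with step M c | h
  ... | nothing | _ = run-halted d c h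

  run-+ : ∀ a b c → run (a + b) c ≡ run b (run a c)
  run-+ zero    b c = refl
  run-+ (suc a) b c = run-+ a b (next c)

  run-after-halting : ∀ c t N c' → t ≤ N → steps M t c ≡ just c' → Halted M c' → run N c ≡ c'
  run-after-halting c t N c' t≤N e h = begin
    run N c                  ≡⟨ cong (λ z → run z c) (m+[n∸m]≡n t≤N) ⟨
    run (t + (N ∸ t)) c      ≡⟨ run-+ t (N ∸ t) c ⟩
    run (N ∸ t) (run t c)    ≡⟨ cong (run (N ∸ t)) (steps⇒run t c c' e) ⟩
    run (N ∸ t) c'           ≡⟨ run-halted (N ∸ t) c' h ⟩
    c'                       ∎
    where open ≡-Reasoning

-- The tape is held as  left ʳ++ right  with the head on the first cell of right:
-- rLeft holds the cells left of the head, nearest first, rRight the rest of the tape.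
module Simulation {A : Set} {k : ℕ} (enc : A ↔ Fin k) (M : TM A) where
  open TM M
  open Codes enc nE public
  open Tapes M public
  open CopyMove K public

  record TapeRep (c : Config M) (φ : Store) (bound : ℕ) : Set where
    constructor tapeRep
    field
      left right : List Γ
      left-reg   : φ rLeft ≡ map code left
      right-reg  : φ rRight ≡ map code right
      pos-left   : Config.pos c ≡ length left
      tape-lists : ∀ i → Config.tape c i ≡ listTape M (left ʳ++ right) i
      state-reg  : head (φ rState) ≡ just (toℕ (Config.state c))
      size       : length left + length right ≤ bound

  open TapeRep

  record Untouched (φ φ' : Store) : Set where
    constructor untouched
    field
      in-same  : φ' rIn ≡ φ rIn
      rev-same : φ' rRev ≡ φ rRev
      out-same : φ' rOut ≡ φ rOut

  untouched-trans : ∀ {φ φ₁ φ₂} → Untouched φ φ₁ → Untouched φ₁ φ₂ → Untouched φ φ₂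
  untouched-trans (untouched i₁ r₁ o₁) (untouched i₂ r₂ o₂) =
    untouched (trans i₂ i₁) (trans r₂ r₁) (trans o₂ o₁)

  frame⇒untouched : ∀ ws {φ φ'} → Frame ws φ φ' →
                    T (fresh rIn ws) → T (fresh rRev ws) → T (fresh rOut ws) → Untouched φ φ'
  frame⇒untouched ws fr i r o = untouched (fr rIn i) (fr rRev r) (fr rOut o)

  padBlank : STerm
  padBlank = copyTop rRight rTmp ⨾ IFS rTmp K (atomS (PUSH blankCode rRight))

  padBlank-rep : ∀ c φ b → TapeRep c φ b →
                 Reaches padBlank φ λ φ' →
                     Σ (TapeRep c φ' (suc b)) (λ R → right R ≢ []) × Untouched φ φ'
  padBlank-rep c φ b (tapeRep l [] eL eR eP eT eS size) with copyTop-empty rRight rTmp φ (λ ()) eR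
  ... | φ₁ , copied , φ₁tmp , frame =
    φ₂ , seq-just (copyTop rRight rTmp) pad copied (if-true rTmp K (atomS (PUSH blankCode rRight)) φ₁ (cong head φ₁tmp)) ,
    (tapeRep l (blank ∷ []) (trans (fr₂ rLeft tt) eL)
             (trans (update-same φ₁ rRight _) (cong (blankCode ∷_) (trans (frame rRight tt) eR)))
             eP (λ i → trans (eT i) (extend i)) (trans (cong head (fr₂ rState tt)) eS)
             (≤-trans (≤-reflexive (+-suc (length l) 0)) (s≤s size)) , λ ()) ,
    frame⇒untouched (rTmp ∷ rRight ∷ []) fr₂ tt tt tt
    where
      pad = IFS rTmp K (atomS (PUSH blankCode rRight))
      φ₂ = update φ₁ rRight (blankCode ∷ φ₁ rRight)
      fr₂ : Frame (rTmp ∷ rRight ∷ []) φ φ₂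
      fr₂ = frame-++ (rTmp ∷ []) (rRight ∷ []) frame (frame-update φ₁ rRight _)
      extend : ∀ i → listTape M (l ʳ++ []) i ≡ listTape M (l ʳ++ blank ∷ []) i
      extend i rewrite ʳ++-defn l {[]} | ʳ++-defn l {blank ∷ []} | ++-identityʳ (reverse l) =
        listTape-∷ʳ-blank (reverse l) i
  padBlank-rep c φ b (tapeRep l (g ∷ r) eL eR eP eT eS size)
    with copyTop-cons rRight rTmp φ (code g) (map code r) (λ ()) eR (code<K g)
  ... | φ₁ , copied , φ₁tmp , frame =
    φ₁ , seq-just (copyTop rRight rTmp) pad copied
           (if-false rTmp K (atomS (PUSH blankCode rRight)) φ₁ (head-≢ (cong head φ₁tmp) (<⇒≢ (code<K g)))) ,
    (tapeRep l (g ∷ r) (trans (frame rLeft tt) eL) (trans (frame rRight tt) eR) eP eT (trans (cong head (frame rState tt)) eS)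
             (≤-trans size (n≤1+n b)) , λ ()) ,
    frame⇒untouched (rTmp ∷ []) frame tt tt tt
    where pad = IFS rTmp K (atomS (PUSH blankCode rRight))

  moveCode : Move → ℕ
  moveCode L = 0
  moveCode R = 1

  -- The code 2 means that the machine has halted and the head stays.
  moveHead : STerm
  moveHead = IFS rMove 0 (moveTop rLeft rRight) ⨾ IFS rMove 1 (moveTop rRight rLeft)

  moveHead-idle : ∀ φ → head (φ rMove) ≡ just 2 → evalS moveHead φ ≡ just φ
  moveHead-idle φ h = seq-just (IFS rMove 0 (moveTop rLeft rRight)) (IFS rMove 1 (moveTop rRight rLeft))
                        (if-false rMove 0 (moveTop rLeft rRight) φ (head-≢ h λ ()))
                        (if-false rMove 1 (moveTop rRight rLeft) φ (head-≢ h λ ()))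

  moveHead-rep : ∀ q t h φ b m (Rep : TapeRep (conf q t h) φ b) → right Rep ≢ [] →
                 head (φ rMove) ≡ just (moveCode m) →
                 Reaches moveHead φ λ φ' → TapeRep (conf q t (move M m h)) φ' b × Untouched φ φ'
  moveHead-rep q t h φ b L (tapeRep [] r eL eR eP eT eS size) _ hM with moveTop-empty rLeft rRight φ (λ ()) eL
  ... | φ₁ , moved , fr =
    φ₁ , seq-just (IFS rMove 0 (moveTop rLeft rRight)) (IFS rMove 1 (moveTop rRight rLeft))
           (trans (if-true rMove 0 (moveTop rLeft rRight) φ hM) moved)
           (if-false rMove 1 (moveTop rRight rLeft) φ₁ (head-≢ (trans (cong head (fr rMove tt)) hM) λ ())) ,
    tapeRep [] r (trans (fr rLeft tt) eL) (trans (fr rRight tt) eR) (cong (move M L) eP) eT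
               (trans (cong head (fr rState tt)) eS) size ,
    frame⇒untouched (rTmp ∷ []) fr tt tt tt
  moveHead-rep q t h φ b L (tapeRep (x ∷ l) r eL eR eP eT eS size) _ hM
    with moveTop-cons rLeft rRight φ (code x) (map code l) (λ ()) (λ ()) (λ ()) eL (code<K x)
  ... | φ₁ , moved , φ₁L , φ₁R , fr =
    φ₁ , seq-just (IFS rMove 0 (moveTop rLeft rRight)) (IFS rMove 1 (moveTop rRight rLeft))
           (trans (if-true rMove 0 (moveTop rLeft rRight) φ hM) moved)
           (if-false rMove 1 (moveTop rRight rLeft) φ₁ (head-≢ (trans (cong head (fr rMove tt)) hM) λ ())) ,
    tapeRep l (x ∷ r) φ₁L (trans φ₁R (cong (code x ∷_) eR)) (cong (move M L) eP) eT
               (trans (cong head (fr rState tt)) eS) (≤-trans (≤-reflexive (+-suc (length l) (length r))) size) ,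
    frame⇒untouched (rTmp ∷ rLeft ∷ rRight ∷ []) fr tt tt tt
  moveHead-rep q t h φ b R (tapeRep l [] eL eR eP eT eS size) nonEmpty hM = ⊥-elim (nonEmpty refl)
  moveHead-rep q t h φ b R (tapeRep l (g ∷ r) eL eR eP eT eS size) _ hM
    with moveTop-cons rRight rLeft φ (code g) (map code r) (λ ()) (λ ()) (λ ()) eR (code<K g)
  ... | φ₁ , moved , φ₁R , φ₁L , fr =
    φ₁ , seq-just (IFS rMove 0 (moveTop rLeft rRight)) (IFS rMove 1 (moveTop rRight rLeft))
           (if-false rMove 0 (moveTop rLeft rRight) φ (head-≢ hM λ ()))
           (trans (if-true rMove 1 (moveTop rRight rLeft) φ hM) moved) ,
    tapeRep (g ∷ l) r (trans φ₁L (cong (code g ∷_) eL)) φ₁R (cong suc eP) eT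
               (trans (cong head (fr rState tt)) eS) (≤-trans (≤-reflexive (sym (+-suc (length l) (length r)))) size) ,
    frame⇒untouched (rTmp ∷ rRight ∷ rLeft ∷ []) fr tt tt tt

  transition : ℕ → Fin nQ → Γ → Move → STerm
  transition c q' b m = ((atomS (POP c rRight) ⨾ atomS (PUSH (code b) rRight))
                       ⨾ atomS (PUSH (toℕ q') rNext)) ⨾ atomS (PUSH (moveCode m) rMove)

  onTransition : ℕ → Maybe (Fin nQ × Γ × Move) → STerm
  onTransition c nothing             = atomS SKIP
  onTransition c (just (q' , b , m)) = transition c q' b m

  transitionOf : ℕ → ℕ → Maybe (Fin nQ × Γ × Move)
  transitionOf qn c = decodeFin nQ qn >>= λ q → decode c >>= δ q

  transitionOf-codes : ∀ q g → transitionOf (toℕ q) (code g) ≡ δ q g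
  transitionOf-codes q g rewrite decodeFin-toℕ nQ q | decode-code g = refl

  transitionRegs : List Reg
  transitionRegs = rRight ∷ rRight ∷ rNext ∷ rMove ∷ []

  onTransition-frame : ∀ c o φ φ' → evalS (onTransition c o) φ ≡ just φ' → Frame transitionRegs φ φ'
  onTransition-frame c nothing             φ .φ refl = λ _ _ → refl
  onTransition-frame c (just (q' , b , m)) φ φ' e    = loopFree-frame (transition c q' b m) (((tt , tt) , tt) , tt) φ φ' e

  transition-eval : ∀ φ c s q' b m → φ rRight ≡ c ∷ s →
    evalS (transition c q' b m) φ
      ≡ just (update (update (update (update φ rRight s) rRight (code b ∷ s)) rNext (toℕ q' ∷ φ rNext))
                     rMove (moveCode m ∷ φ rMove))
  transition-eval φ c s q' b m e rewrite pop-eval c rRight φ s e = refl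

  dispatch : STerm
  dispatch = switch rState nQ λ qn → switch rSym K λ c → onTransition c (transitionOf qn c)

  dispatch-eval : ∀ φ q g → head (φ rState) ≡ just (toℕ q) → head (φ rSym) ≡ just (code g) →
                  evalS dispatch φ ≡ evalS (onTransition (code g) (δ q g)) φ
  dispatch-eval φ q g hq hg = trans (switch-hit rState nQ _ φ (toℕ q) hq (toℕ<n q) keeps-state) onSymbol
    where
      onSymbol : evalS (switch rSym K λ c → onTransition c (transitionOf (toℕ q) c)) φ
                 ≡ evalS (onTransition (code g) (δ q g)) φ
      onSymbol = trans (switch-hit rSym K _ φ (code g) hg (code<K g)
                          λ φ' e → onTransition-frame (code g) (transitionOf (toℕ q) (code g)) φ φ' e rSym tt)
                       (cong (λ o → evalS (onTransition (code g) o) φ) (transitionOf-codes q g))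
      keeps-state : ∀ φ' → evalS (switch rSym K λ c → onTransition c (transitionOf (toℕ q) c)) φ ≡ just φ' →
                    φ' rState ≡ φ rState
      keeps-state φ' e = onTransition-frame (code g) (δ q g) φ φ' (trans (sym onSymbol) e) rState tt

  setState : STerm
  setState = switch rNext nQ λ qn → atomS (PUSH qn rState)

  execute : STerm
  execute = dispatch ⨾ (setState ⨾ moveHead)

  afterTransition : Fin nQ → (ℕ → Γ) → ℕ → Maybe (Fin nQ × Γ × Move) → Config M
  afterTransition q t h nothing            = conf q t h
  afterTransition q t h (just (q' , a , m)) = conf q' (writeTape M t h a) (move M m h)

  next-scanning : ∀ q t h g → t h ≡ g → next (conf q t h) ≡ afterTransition q t h (δ q g)
  next-scanning q t h g refl with δ q (t h)
  ... | nothing = refl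
  ... | just _  = refl

  setState-idle : ∀ φ → head (φ rNext) ≡ just nQ → evalS setState φ ≡ just φ
  setState-idle φ h = switch-above rNext nQ _ φ nQ h ≤-refl

  setState-hit : ∀ φ q → head (φ rNext) ≡ just (toℕ q) →
                 evalS setState φ ≡ just (update φ rState (toℕ q ∷ φ rState))
  setState-hit φ q h = switch-hit rNext nQ _ φ (toℕ q) h (toℕ<n q) λ { _ refl → refl }

  execute-rep : ∀ q t h φ b (Rep : TapeRep (conf q t h) φ b) g rs → right Rep ≡ g ∷ rs →
                head (φ rSym) ≡ just (code g) → head (φ rNext) ≡ just nQ → head (φ rMove) ≡ just 2 →
                Reaches execute φ λ φ' → TapeRep (next (conf q t h)) φ' b × Untouched φ φ'
  execute-rep q t h φ b Rep@(tapeRep l _ eL eR eP eT eS size) g rs refl hg hNext hMove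
    with fire (δ q g)
    where
      fire : ∀ o → Σ Store λ φ' → (evalS (onTransition (code g) o) φ >>= evalS (setState ⨾ moveHead)) ≡ just φ'
                                   × TapeRep (afterTransition q t h o) φ' b × Untouched φ φ'
      fire nothing =
        φ , seq-just setState moveHead (setState-idle φ hNext) (moveHead-idle φ hMove) , Rep , untouched refl refl refl
      fire (just (q' , a , m)) rewrite transition-eval φ (code g) (map code rs) q' a m eR
        with moveHead-rep q' (writeTape M t h a) h φ₂ b m
               (tapeRep l (a ∷ rs) eL refl eP (writeTape-ʳ++ t l g a rs h eP eT) refl size) (λ ()) refl
        where
          φ₁ = update (update (update (update φ rRight (map code rs)) rRight (code a ∷ map code rs))
                              rNext (toℕ q' ∷ φ rNext)) rMove (moveCode m ∷ φ rMove)
          φ₂ = update φ₁ rState (toℕ q' ∷ φ₁ rState)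
      ... | φ' , moved , Rep' , unt =
        φ' , seq-just setState moveHead (setState-hit _ q' refl) moved , Rep' ,
        untouched-trans (untouched refl refl refl) unt
  ... | φ' , ran , Rep' , unt =
    φ' , trans (cong (_>>= evalS (setState ⨾ moveHead)) (dispatch-eval φ q g eS hg)) ran ,
    subst (λ c → TapeRep c φ' b) (sym (next-scanning q t h g (trans (eT h) (listTape-ʳ++-at l g rs h eP)))) Rep' ,
    unt

  tapeRep-frame : ∀ ws {c φ φ' b} → Frame ws φ φ' →
                  T (fresh rLeft ws) → T (fresh rRight ws) → T (fresh rState ws) → TapeRep c φ b → TapeRep c φ' b
  tapeRep-frame ws fr fL fR fS (tapeRep l r eL eR eP eT eS size) =
    tapeRep l r (trans (fr rLeft fL) eL) (trans (fr rRight fR) eR) eP eT (trans (cong head (fr rState fS)) eS) size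

  -- Reads the scanned symbol into rSym and leaves the sentinels nQ and 2 in rNext and
  -- rMove, which remain on top when no transition fires.
  scan : STerm
  scan = copyTop rRight rSym ⨾ (atomS (PUSH nQ rNext) ⨾ atomS (PUSH 2 rMove))

  scan-rep : ∀ c φ b (Rep : TapeRep c φ b) g rs → right Rep ≡ g ∷ rs →
             Reaches scan φ λ φ' → Σ (TapeRep c φ' b) (λ R → right R ≡ g ∷ rs)
               × head (φ' rSym) ≡ just (code g) × head (φ' rNext) ≡ just nQ × head (φ' rMove) ≡ just 2
               × Untouched φ φ'
  scan-rep c φ b Rep g rs eq
    with copyTop-cons rRight rSym φ (code g) (map code rs) (λ ()) (trans (right-reg Rep) (cong (map code) eq)) (code<K g)
  ... | φ₁ , read , φ₁Sym , fr =
    φ₂ , seq-just (copyTop rRight rSym) (atomS (PUSH nQ rNext) ⨾ atomS (PUSH 2 rMove)) read refl ,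
    (tapeRep-frame ws fr₂ tt tt tt Rep , eq) , cong head φ₁Sym , refl , refl , frame⇒untouched ws fr₂ tt tt tt
    where
      ws = rSym ∷ rNext ∷ rMove ∷ []
      φ₂ = update (update φ₁ rNext (nQ ∷ φ₁ rNext)) rMove (2 ∷ φ₁ rMove)
      fr₂ : Frame ws φ φ₂
      fr₂ = frame-++ (rSym ∷ []) (rNext ∷ rMove ∷ []) fr
              (frame-++ (rNext ∷ []) (rMove ∷ []) (frame-update φ₁ rNext _) (frame-update _ rMove _))

  simulateStep : STerm
  simulateStep = padBlank ⨾ (scan ⨾ execute)

  simulateStep-rep : ∀ c φ b → TapeRep c φ b →
                     Reaches simulateStep φ λ φ' → TapeRep (next c) φ' (suc b) × Untouched φ φ'
  simulateStep-rep (conf q t h) φ b Rep =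
    reaches-⨾ padBlank (scan ⨾ execute) (padBlank-rep (conf q t h) φ b Rep) λ {φ₁} ((Rep₁ , nonEmpty) , unt₁) →
    reaches-mono (scan ⨾ execute) φ₁ (λ (Rep' , unt) → Rep' , untouched-trans unt₁ unt) (scanned φ₁ Rep₁ nonEmpty)
    where
      scanned : ∀ φ₁ (Rep₁ : TapeRep (conf q t h) φ₁ (suc b)) → right Rep₁ ≢ [] →
                Reaches (scan ⨾ execute) φ₁ λ φ' → TapeRep (next (conf q t h)) φ' (suc b) × Untouched φ₁ φ'
      scanned φ₁ Rep₁ nonEmpty with right Rep₁ in eq
      ... | []     = ⊥-elim (nonEmpty refl)
      ... | g ∷ rs =
        reaches-⨾ scan execute (scan-rep _ φ₁ _ Rep₁ g rs eq)
          λ {φ₂} ((Rep₂ , eq₂) , hSym , hNext , hMove , unt₂) →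
        reaches-mono execute φ₂ (λ (Rep' , unt) → Rep' , untouched-trans unt₂ unt)
          (execute-rep q t h φ₂ _ Rep₂ g rs eq₂ hSym hNext hMove)

All-ʳ++ : ∀ {B : Set} {P : B → Set} {xs ys : List B} → All P xs → All P ys → All P (xs ʳ++ ys)
All-ʳ++ []       qs = qs
All-ʳ++ (p ∷ ps) qs = All-ʳ++ ps (p ∷ qs)

replicate-ʳ++ : ∀ {B : Set} z (x : B) ys → replicate z x ʳ++ ys ≡ replicate z x ++ ys
replicate-ʳ++ zero    x ys = refl
replicate-ʳ++ (suc z) x ys = trans (replicate-ʳ++ z x (x ∷ ys)) (shift z)
  where
    shift : ∀ z → replicate z x ++ x ∷ ys ≡ x ∷ replicate z x ++ ys
    shift zero    = refl
    shift (suc z) = cong (x ∷_) (shift z)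

pushBodies : ℕ → ℕ → List STerm
pushBodies o zero    = []
pushBodies o (suc m) = atomS (PUSH (suc o) rRight) ∷ pushBodies (suc o) m

-- On the symbol i the loop body pushes i, so ROF copies rIn onto rRight in order.
copyInput : ℕ → STerm
copyInput k = ROF rIn (atomS (PUSH 0 rRight)) (pushBodies 0 (pred k))

pushBodies-eval : ∀ o m i φ → i ≤ m →
                  evalC (atomS (PUSH o rRight)) (pushBodies o m) i φ ≡ just (update φ rRight ((o + i) ∷ φ rRight))
pushBodies-eval o zero    .zero   φ z≤n       rewrite +-identityʳ o = refl
pushBodies-eval o (suc m) zero    φ _         rewrite +-identityʳ o = refl
pushBodies-eval o (suc m) (suc i) φ (s≤s i≤m) rewrite pushBodies-eval (suc o) m i φ i≤m | +-suc o i = refl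

pushAll-eval : ∀ k xs φ → All (_< k) xs →
               Σ Store λ φ' → evalLoop (evalC (atomS (PUSH 0 rRight)) (pushBodies 0 (pred k))) xs φ ≡ just φ'
                 × φ' rRight ≡ xs ʳ++ φ rRight × Frame (rRight ∷ []) φ φ'
pushAll-eval k []       φ []           = φ , refl , refl , λ _ _ → refl
pushAll-eval k (x ∷ xs) φ (x<k ∷ xs<k) with pushAll-eval k xs (update φ rRight (x ∷ φ rRight)) xs<k
... | φ' , pushed , φ'R , fr =
  φ' , trans (cong (_>>= evalLoop _ xs) (pushBodies-eval 0 (pred k) x φ (<⇒≤pred x<k))) pushed ,
  φ'R , λ z t → trans (fr z t) (frame-update φ rRight _ z t)

∉-written : ∀ {x : Reg} {ws} → All (x ≢_) ws → x ∉ ws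
∉-written = All¬⇒¬Any

module _ {Q : Reg → Set} where

  switch-writes : ∀ x n B → (∀ c → All Q (writtenS (B c))) → All Q (writtenS (switch x n B))
  switch-writes x zero    B h = []
  switch-writes x (suc n) B h = ++⁺ (switch-writes x n B h) (h n)

  repeat-writes : ∀ a B → All Q (writtenS B) → All Q (writtenS (repeat a B))
  repeat-writes zero    B h = []
  repeat-writes (suc a) B h = ++⁺ h (repeat-writes a B h)

  polyLoop-writes : ∀ p B → All Q (writtenS B) → All Q (writtenS (polyLoop p B))
  polyLoop-writes []       B h = []
  polyLoop-writes (a ∷ as) B h = ++⁺ (repeat-writes a B h) (++⁺ (polyLoop-writes as B h) [])

  polyLoop⁺-writes : ∀ p B → All Q (writtenS B) → All Q (writtenS (polyLoop⁺ p B))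
  polyLoop⁺-writes p B h = ++⁺ (polyLoop-writes p B h) (++⁺ h [])

  switch-iters : ∀ x n B → (∀ c → All Q (itersS (B c))) → All Q (itersS (switch x n B))
  switch-iters x zero    B h = []
  switch-iters x (suc n) B h = ++⁺ (switch-iters x n B h) (h n)

  repeat-iters : ∀ a B → All Q (itersS B) → All Q (itersS (repeat a B))
  repeat-iters zero    B h = []
  repeat-iters (suc a) B h = ++⁺ h (repeat-iters a B h)

  polyLoop-iters : ∀ p B → Q rIn → All Q (itersS B) → All Q (itersS (polyLoop p B))
  polyLoop-iters []       B q h = []
  polyLoop-iters (a ∷ as) B q h = ++⁺ (repeat-iters a B h) (q ∷ ++⁺ (polyLoop-iters as B q h) [])

  polyLoop⁺-iters : ∀ p B → Q rIn → All Q (itersS B) → All Q (itersS (polyLoop⁺ p B))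
  polyLoop⁺-iters p B q h = ++⁺ (polyLoop-iters p B q h) (q ∷ ++⁺ h [])

switch-wf : ∀ x n B → (∀ c → wfS (B c)) → (∀ c → All (x ≢_) (writtenS (B c))) → wfS (switch x n B)
switch-wf x zero    B wf h = tt
switch-wf x (suc n) B wf h = switch-wf x n B wf h , ∉-written (h n) , wf n

repeat-wf : ∀ a B → wfS B → wfS (repeat a B)
repeat-wf zero    B wf = tt
repeat-wf (suc a) B wf = wf , repeat-wf a B wf

polyLoop-wf : ∀ p B → wfS B → All (rIn ≢_) (writtenS B) → wfS (polyLoop p B)
polyLoop-wf []       B wf h = tt
polyLoop-wf (a ∷ as) B wf h = repeat-wf a B wf , ∉-written (++⁺ (polyLoop-writes as B h) []) , polyLoop-wf as B wf h , tt

polyLoop⁺-wf : ∀ p B → wfS B → All (rIn ≢_) (writtenS B) → wfS (polyLoop⁺ p B)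
polyLoop⁺-wf p B wf h = polyLoop-wf p B wf h , ∉-written (++⁺ h []) , wf , tt

module _ (K : ℕ) where
  open CopyMove K

  copyTop-writes : ∀ {Q : Reg → Set} X Z → Q Z → All Q (writtenS (copyTop X Z))
  copyTop-writes X Z qZ = qZ ∷ switch-writes X K _ (λ c → qZ ∷ [])

  moveTop-writes : ∀ {Q : Reg → Set} X Y → Q rTmp → Q X → Q Y → All Q (writtenS (moveTop X Y))
  moveTop-writes X Y qT qX qY = ++⁺ (copyTop-writes X rTmp qT) (switch-writes rTmp K _ (λ c → qX ∷ qY ∷ []))

  copyTop-wf : ∀ X Z → X ≢ Z → wfS (copyTop X Z)
  copyTop-wf X Z X≢Z = tt , switch-wf X K _ (λ c → tt) (λ c → X≢Z ∷ [])

  moveTop-wf : ∀ X Y → X ≢ rTmp → Y ≢ rTmp → wfS (moveTop X Y)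
  moveTop-wf X Y X≢tmp Y≢tmp =
    copyTop-wf X rTmp X≢tmp , switch-wf rTmp K _ (λ c → tt , tt) (λ c → ≢-sym X≢tmp ∷ ≢-sym Y≢tmp ∷ [])

  copyTop-iters : ∀ {Q : Reg → Set} X Z → All Q (itersS (copyTop X Z))
  copyTop-iters X Z = switch-iters X K _ (λ c → [])

  moveTop-iters : ∀ {Q : Reg → Set} X Y → All Q (itersS (moveTop X Y))
  moveTop-iters X Y = ++⁺ (copyTop-iters X rTmp) (switch-iters rTmp K _ (λ c → []))

module Compilation {A : Set} {k : ℕ} (enc : A ↔ Fin k) (M : TM A) (p : Poly) where
  open TM M
  open Simulation enc M
  open Strip blankCode
  open TapeRep

  load : STerm
  load = copyInput k ⨾ atomS (PUSH (toℕ start) rState)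

  -- The output tape goes to rRev reversed, loses its trailing blanks there and is
  -- reversed again into rOut.
  extract : STerm
  extract = polyLoop⁺ p (moveTop rRight rRev) ⨾ (polyLoop⁺ p (strip rRev) ⨾ polyLoop⁺ p (moveTop rRev rOut))

  program : STerm
  program = load ⨾ (polyLoop p simulateStep ⨾ extract)

  reverse-output : ∀ u z → reverse (map code (map inj₁ u ++ replicate z blank))
                           ≡ replicate z blankCode ++ reverse (encodeWord u)
  reverse-output u z = begin
    reverse (map code (map inj₁ u ++ replicate z blank))
      ≡⟨ cong reverse (map-++ code (map inj₁ u) (replicate z blank)) ⟩
    reverse (map code (map inj₁ u) ++ map code (replicate z blank))
      ≡⟨ reverse-++ (map code (map inj₁ u)) (map code (replicate z blank)) ⟩
    reverse (map code (replicate z blank)) ++ reverse (map code (map inj₁ u))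
      ≡⟨ cong₂ (λ a b → reverse a ++ reverse b) (map-replicate code z blank) (code-inj₁ u) ⟩
    reverse (replicate z blankCode) ++ reverse (encodeWord u)
      ≡⟨ cong (_++ reverse (encodeWord u)) (trans (replicate-ʳ++ z blankCode []) (++-identityʳ _)) ⟩
    replicate z blankCode ++ reverse (encodeWord u)
      ∎
    where open ≡-Reasoning

  OutputFree : Stack → Store → Set
  OutputFree inp φ = φ rIn ≡ inp × φ rOut ≡ []

  outputFree-frame : ∀ {inp} ws → T (fresh rIn ws) → T (fresh rOut ws) →
                     ∀ φ φ' → Frame ws φ φ' → OutputFree inp φ → OutputFree inp φ'
  outputFree-frame ws fIn fOut φ φ' fr (e₁ , e₂) = trans (fr rIn fIn) e₁ , trans (fr rOut fOut) e₂

  unload-eval : ∀ inp φ r → OutputFree inp φ → φ rRight ≡ map code r → φ rRev ≡ [] →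
                length r ≤ sweeps p inp →
                Reaches (polyLoop⁺ p (moveTop rRight rRev)) φ λ φ' →
                    OutputFree inp φ' × φ' rRev ≡ reverse (map code r)
  unload-eval inp φ r free φR φRev r≤ =
    Drain.drain K rRight rRev (λ ()) (λ ()) (λ ()) (map code r) inp (OutputFree inp) (λ _ → proj₁)
      (outputFree-frame (rTmp ∷ rRight ∷ rRev ∷ []) tt tt) p φ free φR φRev (codes<K r)
      (≤-trans (≤-reflexive (length-map code r)) r≤)

  trim-eval : ∀ inp φ u z → OutputFree inp φ → φ rRev ≡ replicate z blankCode ++ reverse (encodeWord u) →
              z ≤ sweeps p inp →
              Reaches (polyLoop⁺ p (strip rRev)) φ λ φ' →
                  OutputFree inp φ' × φ' rRev ≡ reverse (encodeWord u)
  trim-eval inp φ u z free φRev z≤ =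
    Trim.trim blankCode rRev (λ ()) (reverse (encodeWord u)) (head≢blankCode (All-ʳ++ (encodeWord<k u) [])) z
      inp (OutputFree inp) (λ _ → proj₁) (outputFree-frame (rTmp ∷ rRev ∷ []) tt tt) p φ free φRev z≤

  output-eval : ∀ inp φ u → OutputFree inp φ → φ rRev ≡ reverse (encodeWord u) → length u ≤ sweeps p inp →
                Reaches (polyLoop⁺ p (moveTop rRev rOut)) φ λ φ' → φ' rOut ≡ encodeWord u
  output-eval inp φ u (φIn , φOut) φRev u≤
    with Drain.drain K rRev rOut (λ ()) (λ ()) (λ ()) (reverse (encodeWord u)) inp (λ φ → φ rIn ≡ inp) (λ _ e → e)
           (λ φ φ' fr e → trans (fr rIn tt) e) p φ φIn φRev φOut
           (All-ʳ++ (All.map (λ c<k → ≤-trans c<k (m≤m+n k (suc nE))) (encodeWord<k u)) [])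
           (≤-trans (≤-reflexive (trans (length-reverse (encodeWord u)) (length-map (λ a → toℕ (Inverse.to enc a)) u)))
                    u≤)
  ... | φ' , moved , _ , φ'Out = φ' , moved , trans φ'Out (reverse-involutive (encodeWord u))

  extract-eval : ∀ inp c φ b u → OutputFree inp φ → φ rRev ≡ [] → TapeRep c φ b →
                 Config.pos c ≡ 0 → (∀ i → Config.tape c i ≡ listTape M (map inj₁ u) i) → b ≤ sweeps p inp →
                 Reaches extract φ λ φ' → φ' rOut ≡ encodeWord u
  extract-eval inp c φ b u free φRev (tapeRep [] r eL eR eP eT eS size) pos0 tape-u b≤ =
    reaches-⨾ (polyLoop⁺ p (moveTop rRight rRev)) (polyLoop⁺ p (strip rRev) ⨾ polyLoop⁺ p (moveTop rRev rOut))
      (unload-eval inp φ r free eR φRev r≤) λ (free₁ , φ₁Rev) →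
    reaches-⨾ (polyLoop⁺ p (strip rRev)) (polyLoop⁺ p (moveTop rRev rOut))
      (trim-eval inp _ u z free₁ (trans φ₁Rev (trans (cong (reverse ∘′ map code) r≡) (reverse-output u z)))
                 (≤-trans (m∸n≤m (length r) (length u)) r≤)) λ (free₂ , φ₂Rev) →
    output-eval inp _ u free₂ φ₂Rev u≤
    where
      r≤ = ≤-trans size b≤
      z = length r ∸ length u
      r≡ : r ≡ map inj₁ u ++ replicate z blank
      r≡ = listTape-output r u (λ i → trans (sym (eT i)) (tape-u i))
      u≤ : length u ≤ sweeps p inp
      u≤ = ≤-trans (m≤m+n (length u) z) (≤-trans (≤-reflexive (sym (begin
             length r                                          ≡⟨ cong length r≡ ⟩
             length (map inj₁ u ++ replicate z blank)          ≡⟨ length-++ (map inj₁ u) ⟩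
             length (map inj₁ u) + length (replicate z blank)  ≡⟨ cong₂ _+_ (length-map inj₁ u) (length-replicate z) ⟩
             length u + z                                      ∎))) r≤)
        where open ≡-Reasoning
  extract-eval inp c φ b u free φRev (tapeRep (x ∷ l) r eL eR eP eT eS size) pos0 tape-u b≤ =
    case trans (sym pos0) eP of λ ()

  Simulated : List A → ℕ → Store → Set
  Simulated w j φ =
    OutputFree (encodeWord w) φ × φ rRev ≡ [] × TapeRep (run j (initConf M w)) φ (length (encodeWord w) + j)

  load-eval : ∀ w → Reaches load (update emptyStore rIn (encodeWord w)) (Simulated w 0)
  load-eval w with pushAll-eval k (reverse (encodeWord w)) φ₀ (All-ʳ++ (encodeWord<k w) [])
    where φ₀ = update emptyStore rIn (encodeWord w)
  ... | φ₁ , pushed , φ₁R , fr =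
    update φ₁ rState (toℕ start ∷ φ₁ rState) ,
    seq-just (copyInput k) (atomS (PUSH (toℕ start) rState)) {update emptyStore rIn (encodeWord w)} pushed refl ,
    (fr rIn tt , fr rOut tt) , fr rRev tt ,
    tapeRep [] (map inj₁ w) (fr rLeft tt) (trans φ₁R (trans (reverse-involutive _) (sym (code-inj₁ w))))
            refl (λ _ → refl) refl
            (≤-reflexive (trans (length-map inj₁ w) (trans (sym (length-map _ w)) (sym (+-identityʳ _)))))

  simulateStep-advances : ∀ w →
    Iteration.Advances (Simulated w) (encodeWord w) (λ _ _ s → proj₁ (proj₁ s)) simulateStep 1
  simulateStep-advances w j φ ((φIn , φOut) , φRev , Rep) with simulateStep-rep (run j (initConf M w)) φ _ Rep
  ... | φ' , stepped , Rep' , untouched i r o =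
    φ' , stepped , (trans i φIn , trans o φOut) , trans r φRev ,
    subst₂ (λ c b → TapeRep c φ' b) (sym (run-+ j 1 (initConf M w)))
           (sym (trans (cong (length (encodeWord w) +_) (+-comm j 1)) (+-suc _ j))) Rep'

  -- Simulating for evalPoly p n steps reaches the final configuration, since the
  -- machine halts within that time and a halted configuration steps to itself.
  ComputesInTime : (List A → List A) → Set
  ComputesInTime f = ∀ w → Σ[ t ∈ ℕ ] Σ[ c ∈ Config M ]
    t ≤ evalPoly p (length w) × steps M t (initConf M w) ≡ just c
    × Halted M c × Config.pos c ≡ 0 × (∀ i → Config.tape c i ≡ listTape M (map inj₁ (f w)) i)

  program-eval : ∀ f → ComputesInTime f →
                 ∀ w → Reaches program (update emptyStore rIn (encodeWord w)) (λ φ → φ rOut ≡ encodeWord (f w))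
  program-eval f runs w with runs w
  ... | t , c , t≤ , ran , halted , pos0 , tape-fw =
    reaches-⨾ load (polyLoop p simulateStep ⨾ extract) {update emptyStore rIn inp} (load-eval w) λ start →
    reaches-⨾ (polyLoop p simulateStep) extract
      (Iteration.polyLoop-advances (Simulated w) inp (λ _ _ s → proj₁ (proj₁ s)) simulateStep
         (simulateStep-advances w) p 0 _ start)
      λ {φ} (free , φRev , Rep) →
    extract-eval inp c φ (length inp + N) (f w) free φRev (subst (λ c → TapeRep c φ (length inp + N)) finished Rep)
      pos0 tape-fw
      (≤-reflexive (+-comm (length inp) N))
    where
      inp = encodeWord w
      N = evalPoly p (length inp)
      finished : run N (initConf M w) ≡ c
      finished = run-after-halting (initConf M w) t N c
                   (subst (λ m → t ≤ evalPoly p m) (sym (length-map _ w)) t≤) ran halted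

  pushBodies-writes : ∀ {Q : Reg → Set} o m → Q rRight → All Q (writtenL (pushBodies o m))
  pushBodies-writes o zero    q = []
  pushBodies-writes o (suc m) q = q ∷ pushBodies-writes (suc o) m q

  pushBodies-wf : ∀ o m → wfL (pushBodies o m)
  pushBodies-wf o zero    = tt
  pushBodies-wf o (suc m) = tt , pushBodies-wf (suc o) m

  pushBodies-iters : ∀ {Q : Reg → Set} o m → All Q (itersL (pushBodies o m))
  pushBodies-iters o zero    = []
  pushBodies-iters o (suc m) = pushBodies-iters (suc o) m

  onTransition-writes : ∀ {Q : Reg → Set} c o → Q rRight → Q rNext → Q rMove → All Q (writtenS (onTransition c o))
  onTransition-writes c nothing  qR qN qM = []
  onTransition-writes c (just _) qR qN qM = qR ∷ qR ∷ qN ∷ qM ∷ []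

  onTransition-wf : ∀ c o → wfS (onTransition c o)
  onTransition-wf c nothing  = tt
  onTransition-wf c (just _) = ((tt , tt) , tt) , tt

  onTransition-iters : ∀ {Q : Reg → Set} c o → All Q (itersS (onTransition c o))
  onTransition-iters c nothing  = []
  onTransition-iters c (just _) = []

  simulateStep-writes : ∀ {Q : Reg → Set} →
                        Q rLeft → Q rRight → Q rState → Q rSym → Q rNext → Q rMove → Q rTmp →
                        All Q (writtenS simulateStep)
  simulateStep-writes qL qR qSt qSy qN qM qT =
    ++⁺ (++⁺ (copyTop-writes K rRight rTmp qT) (qR ∷ [])) (++⁺ (++⁺ (copyTop-writes K rRight rSym qSy) (qN ∷ qM ∷ []))
      (++⁺ (switch-writes rState nQ _ λ qn →
              switch-writes rSym K _ λ c → onTransition-writes c (transitionOf qn c) qR qN qM)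
      (++⁺ (switch-writes rNext nQ _ λ qn → qSt ∷ [])
           (++⁺ (moveTop-writes K rLeft rRight qT qL qR) (moveTop-writes K rRight rLeft qT qR qL)))))

  simulateStep-wf : wfS simulateStep
  simulateStep-wf =
    (copyTop-wf K rRight rTmp (λ ()) , ∉-written ((λ ()) ∷ []) , tt) , (copyTop-wf K rRight rSym (λ ()) , tt , tt) ,
    switch-wf rState nQ _ (λ qn → switch-wf rSym K _ (λ c → onTransition-wf c (transitionOf qn c))
                                   (λ c → onTransition-writes c (transitionOf qn c) (λ ()) (λ ()) (λ ())))
                          (λ qn → switch-writes rSym K _ λ c →
                                    onTransition-writes c (transitionOf qn c) (λ ()) (λ ()) (λ ())) ,
    switch-wf rNext nQ _ (λ qn → tt) (λ qn → (λ ()) ∷ []) ,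
    (∉-written (moveTop-writes K rLeft rRight (λ ()) (λ ()) (λ ())) , moveTop-wf K rLeft rRight (λ ()) (λ ())) ,
    (∉-written (moveTop-writes K rRight rLeft (λ ()) (λ ()) (λ ())) , moveTop-wf K rRight rLeft (λ ()) (λ ()))

  simulateStep-iters : ∀ {Q : Reg → Set} → All Q (itersS simulateStep)
  simulateStep-iters =
    ++⁺ (++⁺ (copyTop-iters K rRight rTmp) []) (++⁺ (++⁺ (copyTop-iters K rRight rSym) [])
      (++⁺ (switch-iters rState nQ _ λ qn → switch-iters rSym K _ λ c → onTransition-iters c (transitionOf qn c))
      (++⁺ (switch-iters rNext nQ _ λ qn → [])
           (++⁺ (moveTop-iters K rLeft rRight) (moveTop-iters K rRight rLeft)))))

  strip-writes : ∀ {Q : Reg → Set} X → Q rTmp → Q X → All Q (writtenS (strip X))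
  strip-writes X qT qX = qT ∷ qT ∷ qX ∷ []

  strip-wf : ∀ X → X ≢ rTmp → wfS (strip X)
  strip-wf X X≢tmp = (tt , ∉-written (X≢tmp ∷ []) , tt) , ∉-written (≢-sym X≢tmp ∷ []) , tt

  program-writes : All (rIn ≢_) (writtenS program)
  program-writes =
    ++⁺ (++⁺ ((λ ()) ∷ pushBodies-writes 0 (pred k) (λ ())) ((λ ()) ∷ []))
        (++⁺ (polyLoop-writes p simulateStep (simulateStep-writes (λ ()) (λ ()) (λ ()) (λ ()) (λ ()) (λ ()) (λ ())))
        (++⁺ (polyLoop⁺-writes p _ (moveTop-writes K rRight rRev (λ ()) (λ ()) (λ ())))
        (++⁺ (polyLoop⁺-writes p _ (strip-writes rRev (λ ()) (λ ())))
             (polyLoop⁺-writes p _ (moveTop-writes K rRev rOut (λ ()) (λ ()) (λ ()))))))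

  program-wf : wfS program
  program-wf =
    ((∉-written ((λ ()) ∷ pushBodies-writes 0 (pred k) (λ ())) , tt , pushBodies-wf 0 (pred k)) , tt) ,
    polyLoop-wf p simulateStep simulateStep-wf (simulateStep-writes (λ ()) (λ ()) (λ ()) (λ ()) (λ ()) (λ ()) (λ ())) ,
    polyLoop⁺-wf p _ (moveTop-wf K rRight rRev (λ ()) (λ ())) (moveTop-writes K rRight rRev (λ ()) (λ ()) (λ ())) ,
    polyLoop⁺-wf p _ (strip-wf rRev (λ ())) (strip-writes rRev (λ ()) (λ ())) ,
    polyLoop⁺-wf p _ (moveTop-wf K rRev rOut (λ ()) (λ ())) (moveTop-writes K rRev rOut (λ ()) (λ ()) (λ ()))

  program-iters : All (_≡ rIn) (itersS program)
  program-iters =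
    ++⁺ (++⁺ (refl ∷ pushBodies-iters 0 (pred k)) [])
        (++⁺ (polyLoop-iters p simulateStep refl simulateStep-iters)
        (++⁺ (polyLoop⁺-iters p _ refl (moveTop-iters K rRight rRev))
        (++⁺ (polyLoop⁺-iters p _ refl [])
             (polyLoop⁺-iters p _ refl (moveTop-iters K rRev rOut)))))

  program-forNo : ForNo (NORMAL rIn [] program)
  program-forNo =
    program-wf , (λ { z (here refl) → ∉-written program-writes }) , λ z z∈ → here (All.lookup program-iters z∈)


corollary1 : (pp : PushPop) (A : Set) (k : ℕ) → A ↔ Fin k →
    (f : List A → List A) → FPTIME A f →
    Σ[ T ∈ Term ] Σ[ inR ∈ Reg ] Σ[ outR ∈ Reg ] Σ[ enc ∈ A ↔ Fin k ]
      (ForNo T × Semantics.Computes pp T inR outR enc f)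
corollary1 pp A k enc f (M , p , runs) = NORMAL rIn [] program , rIn , rOut , enc , program-forNo , computes
  where
    open Compilation enc M p
    computes : Semantics.Computes pp (NORMAL rIn [] program) rIn rOut enc f
    computes w with program-eval f runs w
    ... | φ , ran , φOut = φ , Semantics.t-normal (Soundness.evalS-sound pp program _ φ ran) , φOut
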